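{- Let $\rho$ be a kernel permutation. Let $C^1,\dots,C^{f(\rho)}$ be its feasible cells, listed so that $C^i\prec C^j$ whenever $i<j$. Then for any sequence $\alpha_1,\dots,\alpha_{f(\rho)}$ of permutations of arbitrary lengths, there exists $\pi\in S(\rho)$ such that, for each $i$, the subsequence of $\pi$ formed by the entries in the cell $C^i$ of $\pi$ is order-isomorphic to $\alpha_i$.
   Context: Patterns. An occurrence of $132$ in $\pi\in S_n$ is a triple of positions $i<j<k$ with $\pi(i)<\pi(k)<\pi(j)$. The graph $G_\pi$. $G_\pi$ is the bipartite graph whose vertices are the entries of $\pi$ and the occurrences of $132$ in $\pi$. An entry is adjacent to an occurrence exactly when it is one of the three entries of that occurrence. Kernel. Let $\pi(i_1),\dots,\pi(i_s)$, with $i_1<\dots<i_s$, be the entries in the component of $G_\pi$ containing $n$. This subsequence is the kernel of $\pi$. The permutation $\sigma_\pi\in S_s$ order-isomorphic to it is the kernel shape. Kernel permutations. $\rho$ is a kernel permutation if $\rho=\sigma_\pi$ for some $\pi$. $S(\rho)$ is the set of all permutations, of all lengths, with kernel shape $\rho$. Cells. For $\rho\in S_s$ and $\pi\in S(\rho)\cap S_n$, set $i_0=0$, $i_{s+1}=n+1$, and interpret $\pi(i_{\rho^{ -1}(0)})$ as $0$. For $1\leq m\leq s$ and $1\leq l\leq s+1$, define $$C_{ml}(\pi)=\{\pi(j): i_{l-1}<j<i_l,\ \pi(i_{\rho^{ -1}(m-1)})<\pi(j)<\pi(i_{\rho^{ -1}(m)})\}.$$ Feasibility. The cell $C_{ml}$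 is infeasible if, in $(\rho(1),\dots,\rho(l-1),m-\tfrac12,\rho(l),\dots,\rho(s))$, the inserted entry $m-\tfrac12$ belongs to some occurrence of $132$. Otherwise it is feasible. $f(\rho)$ is the number of feasible cells. Order on cells. For distinct feasible cells, $C_{ml}\prec C_{m'l'}$ if $m\geq m'$ and $l\leq l'$. This is a linear order on the feasible cells. -}

module Defs where

open import Data.Nat using (ℕ; zero; suc; _+_; _*_; _∸_; _≤_; _<_; _<ᵇ_; _≡ᵇ_)
open import Data.Bool using (Bool; true; false; _∧_; if_then_else_)
open import Data.List using (List; []; _∷_; length; map; applyUpTo; filterᵇ)
open import Data.List.Relation.Binary.Permutation.Propositional using (_↭_)
open import Data.List.Relation.Unary.AllPairs using (AllPairs)
open import Data.List.Membership.Propositional using (_∈_)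
open import Data.Product using (Σ; ∃; _×_; _,_)
open import Data.Sum using (_⊎_)
open import Relation.Nullary using (¬_)
open import Relation.Binary.PropositionalEquality using (_≡_; _≢_)
open import Relation.Binary.Construct.Closure.ReflexiveTransitive using (Star)
open import Function.Bundles using (_⇔_)

-- Conventions: a permutation of length n is a list of naturals which is a
-- rearrangement of [1, 2, ..., n].  Positions are 1-based.

-- 1-based lookup, with default 0 (in particular  at xs 0 = 0).
at : List ℕ → ℕ → ℕ
at []       _             = 0
at (x ∷ xs) zero          = 0
at (x ∷ xs) (suc zero)    = x
at (x ∷ xs) (suc (suc k)) = at xs (suc k)

IsPerm : List ℕ → Set
IsPerm π = π ↭ applyUpTo suc (length π)

OrderIso : List ℕ → List ℕ → Set
OrderIso xs ys = length xs ≡ length ys ×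
  (∀ a b → 1 ≤ a → a ≤ length xs → 1 ≤ b → b ≤ length xs →
     (at xs a < at xs b) ⇔ (at ys a < at ys b))

Occ132 : List ℕ → ℕ → ℕ → ℕ → Set
Occ132 π i j k = 1 ≤ i × i < j × j < k × k ≤ length π ×
                 at π i < at π k × at π k < at π j

-- Vertices of the bipartite graph G_π: entries (given by their position)
-- and occurrences of 132 (given by their triple of positions).
data Vtx : Set where
  ent : ℕ → Vtx
  occ : ℕ → ℕ → ℕ → Vtx

Member : ℕ → ℕ → ℕ → ℕ → Set
Member p i j k = p ≡ i ⊎ p ≡ j ⊎ p ≡ k

-- Edges of G_π (both orientations, so the graph is undirected).
data Adj (π : List ℕ) : Vtx → Vtx → Set where
  e-o : ∀ {p i j k} → Occ132 π i j k → Member p i j k → Adj π (ent p) (occ i j k)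
  o-e : ∀ {p i j k} → Occ132 π i j k → Member p i j k → Adj π (occ i j k) (ent p)

InKernel : List ℕ → ℕ → Set
InKernel π p = 1 ≤ p × p ≤ length π ×
  Σ ℕ (λ q → 1 ≤ q × q ≤ length π × at π q ≡ length π × Star (Adj π) (ent p) (ent q))

KernelPos : List ℕ → List ℕ → Set
KernelPos π is = AllPairs _<_ is × (∀ p → (p ∈ is) ⇔ InKernel π p)

KernelShape : List ℕ → List ℕ → Set
KernelShape π ρ = Σ (List ℕ) (λ is → KernelPos π is × OrderIso (map (at π) is) ρ)

InS : List ℕ → List ℕ → Set
InS ρ π = IsPerm π × KernelShape π ρ

KernelPerm : List ℕ → Set
KernelPerm ρ = IsPerm ρ × Σ (List ℕ) (λ π → InS ρ π)

ins : ℕ → ℕ → List ℕ → List ℕ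
ins zero    x ys       = x ∷ ys
ins (suc k) x []       = x ∷ []
ins (suc k) x (y ∷ ys) = y ∷ ins k x ys

-- Cells are pairs (m , l).  C_ml is infeasible iff the entry m - 1/2 inserted
-- at position l of ρ (i.e. before ρ(l)) is in an occurrence of 132.
-- To avoid halves, all values are doubled: ρ(t) ↦ 2ρ(t), m - 1/2 ↦ 2m - 1.
Infeasible : List ℕ → ℕ × ℕ → Set
Infeasible ρ (m , l) =
  let τ = ins (l ∸ 1) (2 * m ∸ 1) (map (2 *_) ρ) in
  Σ ℕ λ i → Σ ℕ λ j → Σ ℕ λ k → Occ132 τ i j k × Member l i j k

Feasible : List ℕ → ℕ × ℕ → Set
Feasible ρ (m , l) = 1 ≤ m × m ≤ length ρ × 1 ≤ l × l ≤ suc (length ρ) ×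
                     ¬ Infeasible ρ (m , l)

Prec : ℕ × ℕ → ℕ × ℕ → Set
Prec (m , l) (m' , l') = (m , l) ≢ (m' , l') × m' ≤ m × l ≤ l'

idx : ℕ → List ℕ → ℕ
idx m []       = 0
idx m (x ∷ xs) = if x ≡ᵇ m then 1 else suc (idx m xs)

-- Boundary positions i_0 = 0, i_l (1 ≤ l ≤ s), i_{s+1} = n + 1.
bnd : List ℕ → List ℕ → ℕ → ℕ
bnd π is zero = 0
bnd π is l    = if l ≡ᵇ suc (length is) then suc (length π) else at is l

-- π(i_{ρ^{-1}(m)}), with the value for m = 0 interpreted as 0.
kval : List ℕ → List ℕ → List ℕ → ℕ → ℕ
kval π is ρ zero = 0
kval π is ρ m    = at π (at is (idx m ρ))

inCellᵇ : List ℕ → List ℕ → List ℕ → ℕ → ℕ → ℕ → Bool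
inCellᵇ π is ρ m l j =
  (bnd π is (l ∸ 1) <ᵇ j) ∧ (j <ᵇ bnd π is l) ∧
  (kval π is ρ (m ∸ 1) <ᵇ at π j) ∧ (at π j <ᵇ kval π is ρ m)

cellSeq : List ℕ → List ℕ → List ℕ → ℕ × ℕ → List ℕ
cellSeq π is ρ (m , l) =
  map (at π) (filterᵇ (inCellᵇ π is ρ m l) (applyUpTo suc (length π)))

-- The permutation π is assembled from tokens: one for each entry of ρ and one for each entry
-- of each αᵢ. The tokens of the i-th cell (m , l) are placed immediately left of the kernel
-- token at position l and immediately below the kernel token of value m, in the pattern of αᵢ;
-- π sends the positional rank of every token to its value rank. The kernel tokens then form a
-- copy of ρ which, through copies of the occurrences of 132 in ρ, is connected to the entry n.
-- Conversely no occurrence of 132 in π mixes kernel and cell tokens, so the kernel of π is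
-- exactly this copy of ρ, and the entries of π in its i-th cell form a copy of αᵢ.

module Submission where

open import Defs
open import Data.Nat using (ℕ; zero; suc; _+_; _*_; _∸_; _≤_; _<_; z≤n; s≤s; _≤ᵇ_; _<ᵇ_; _≡ᵇ_; _≤?_; _<?_)
open import Data.Nat.Properties
open import Data.Bool using (Bool; true; false; T; if_then_else_)
open import Data.Bool.Properties using (T-∧)
open import Data.Unit using (⊤; tt)
open import Data.Empty using (⊥; ⊥-elim)
open import Data.List using (List; []; _∷_; length; map; applyUpTo; filterᵇ; _++_; concat)
open import Data.Nat.ListAction using (sum)
open import Data.List.Properties using (length-map; length-applyUpTo; map-applyUpTo; map-∘; map-cong-local; length-filter; filter-all)
open import Data.List.Membership.Propositional using (_∈_)
open import Data.List.Membership.Propositional.Properties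
  using (∈-map⁻; ∈-map⁺; ∈-++⁻; ∈-++⁺ˡ; ∈-++⁺ʳ; ∈-concat⁻′; ∈-concat⁺′; ∈-applyUpTo⁻; ∈-applyUpTo⁺; ∈-filter⁻; ∈-filter⁺; ∈-∃++)
open import Data.List.Relation.Unary.Any using (here; there)
open import Data.List.Relation.Unary.All as All using (All; []; _∷_)
open import Data.List.Relation.Unary.AllPairs as AllPairs using (AllPairs; []; _∷_)
import Data.List.Relation.Unary.AllPairs.Properties as AllPairsₚ
open import Data.List.Relation.Unary.Unique.Propositional using (Unique)
import Data.List.Relation.Unary.Unique.Propositional.Properties as Uniqueₚ
open import Data.List.Relation.Binary.Pointwise using (Pointwise; []; _∷_)
open import Data.List.Relation.Binary.Permutation.Propositional using (_↭_; ↭-refl; ↭-sym; ↭-trans; ↭-prep; ↭⇒↭ₛ; module PermutationReasoning)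
open import Data.List.Relation.Binary.Permutation.Propositional.Properties using (∈-resp-↭; ↭-length; shift)
  renaming (map⁺ to ↭-map⁺)
open import Data.Product using (Σ; _×_; _,_; proj₁; proj₂)
open import Data.Sum using (_⊎_; inj₁; inj₂)
open import Relation.Nullary using (¬_; yes; no)
open import Relation.Nullary.Decidable using (T?)
open import Relation.Binary.Definitions using (tri<; tri≈; tri>)
open import Relation.Binary.PropositionalEquality using (_≡_; _≢_; refl; sym; trans; cong; cong₂; subst; subst₂; setoid)
import Data.List.Relation.Binary.Permutation.Setoid.Properties as Permutationₛ
open import Relation.Binary.Construct.Closure.ReflexiveTransitive using (Star; ε; _◅_)
open import Function.Bundles using (_⇔_; mk⇔; Equivalence)
open import Function.Construct.Composition using (_⇔-∘_)

private variable A B : Set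

-- Lists of naturals

InRange : ℕ → ℕ → Set
InRange n v = 1 ≤ v × v ≤ n

∈-upTo⁻ : ∀ {n v} → v ∈ applyUpTo suc n → InRange n v
∈-upTo⁻ v∈ with ∈-applyUpTo⁻ suc v∈
... | _ , i<n , refl = s≤s z≤n , i<n

∈-upTo⁺ : ∀ {n v} → InRange n v → v ∈ applyUpTo suc n
∈-upTo⁺ {v = suc v} (_ , v≤n) = ∈-applyUpTo⁺ suc v≤n

upTo-sorted : ∀ n → AllPairs _<_ (applyUpTo suc n)
upTo-sorted n = AllPairsₚ.applyUpTo⁺₁ suc n (λ i<j _ → s≤s i<j)

sorted⇒unique : ∀ {xs} → AllPairs _<_ xs → Unique xs
sorted⇒unique = AllPairs.map <⇒≢

unique-resp-↭ : ∀ {xs ys : List A} → xs ↭ ys → Unique xs → Unique ys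
unique-resp-↭ {A = A} p = Permutationₛ.Unique-resp-↭ (setoid A) (↭⇒↭ₛ p)

unique-⊆-length⇒↭ : ∀ {xs ys : List A} → Unique xs → Unique ys →
  (∀ {v} → v ∈ xs → v ∈ ys) → length xs ≡ length ys → xs ↭ ys
unique-⊆-length⇒↭ {xs = []} {[]} _ _ _ _ = ↭-refl
unique-⊆-length⇒↭ {xs = x ∷ xs} (x∉xs ∷ xs!) ys! xs⊆ys len
  with ys₁ , ys₂ , refl ← ∈-∃++ (xs⊆ys (here refl)) =
  ↭-trans (↭-prep x (unique-⊆-length⇒↭ xs! ys'! xs⊆ys' len')) (↭-sym (shift x ys₁ ys₂))
  where
  ys'! : Unique (ys₁ ++ ys₂)
  ys'! with _ ∷ u ← unique-resp-↭ (shift x ys₁ ys₂) ys! = u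
  xs⊆ys' : ∀ {v} → v ∈ xs → v ∈ ys₁ ++ ys₂
  xs⊆ys' v∈xs with ∈-resp-↭ (shift x ys₁ ys₂) (xs⊆ys (there v∈xs))
  ... | here v≡x = ⊥-elim (All.lookup x∉xs v∈xs (sym v≡x))
  ... | there v∈ = v∈
  len' : length xs ≡ length (ys₁ ++ ys₂)
  len' = suc-injective (trans len (↭-length (shift x ys₁ ys₂)))

unique-inRange⇒↭upTo : ∀ {n} {xs : List ℕ} → Unique xs → (∀ {v} → v ∈ xs → InRange n v) →
  length xs ≡ n → xs ↭ applyUpTo suc n
unique-inRange⇒↭upTo {n} xs! xs⊆ len =
  unique-⊆-length⇒↭ xs! (sorted⇒unique (upTo-sorted n)) (λ v∈ → ∈-upTo⁺ (xs⊆ v∈))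
    (trans len (sym (length-applyUpTo suc n)))

strictlySorted-ext : ∀ {xs ys : List ℕ} → AllPairs _<_ xs → AllPairs _<_ ys →
  (∀ {v} → v ∈ xs → v ∈ ys) → (∀ {v} → v ∈ ys → v ∈ xs) → xs ≡ ys
strictlySorted-ext {[]} {[]} _ _ _ _ = refl
strictlySorted-ext {[]} {y ∷ ys} _ _ _ ys⊆ with () ← ys⊆ (here refl)
strictlySorted-ext {x ∷ xs} {[]} _ _ xs⊆ _ with () ← xs⊆ (here refl)
strictlySorted-ext {x ∷ xs} {y ∷ ys} (x< ∷ xs<) (y< ∷ ys<) xs⊆ ys⊆ =
  cong₂ _∷_ x≡y (strictlySorted-ext xs< ys< (drop xs⊆ x< x≡y) (drop ys⊆ y< (sym x≡y)))
  where
  head≤ : ∀ {u w us ws} → All (u <_) us → (∀ {v} → v ∈ w ∷ ws → v ∈ u ∷ us) → u ≤ w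
  head≤ u< ⊆ with ⊆ (here refl)
  ... | here w≡u = ≤-reflexive (sym w≡u)
  ... | there w∈ = <⇒≤ (All.lookup u< w∈)
  x≡y : x ≡ y
  x≡y = ≤-antisym (head≤ x< ys⊆) (head≤ y< xs⊆)
  drop : ∀ {u w us ws} → (∀ {v} → v ∈ u ∷ us → v ∈ w ∷ ws) → All (u <_) us → u ≡ w →
    ∀ {v} → v ∈ us → v ∈ ws
  drop ⊆ u< refl v∈ with ⊆ (there v∈)
  ... | here refl = ⊥-elim (<-irrefl refl (All.lookup u< v∈))
  ... | there v∈' = v∈'

IsPerm⇒unique : ∀ {xs} → IsPerm xs → Unique xs
IsPerm⇒unique {xs} p = unique-resp-↭ (↭-sym p) (sorted⇒unique (upTo-sorted (length xs)))

IsPerm⇒inRange : ∀ {xs} → IsPerm xs → ∀ {v} → v ∈ xs → InRange (length xs) v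
IsPerm⇒inRange p v∈ = ∈-upTo⁻ (∈-resp-↭ p v∈)

inRange⇒∈IsPerm : ∀ {xs} → IsPerm xs → ∀ {v} → InRange (length xs) v → v ∈ xs
inRange⇒∈IsPerm p v∈ = ∈-resp-↭ (↭-sym p) (∈-upTo⁺ v∈)

at-∷ : ∀ (x : ℕ) xs k → 1 ≤ k → at (x ∷ xs) (suc k) ≡ at xs k
at-∷ x xs (suc k) _ = refl

at-∈ : ∀ (xs : List ℕ) j → InRange (length xs) j → at xs j ∈ xs
at-∈ (x ∷ xs) 1 _ = here refl
at-∈ (x ∷ xs) (suc (suc j)) (_ , s≤s j≤) = there (at-∈ xs (suc j) (s≤s z≤n , j≤))

∈⇒at : ∀ {xs : List ℕ} {v} → v ∈ xs → Σ ℕ λ j → InRange (length xs) j × at xs j ≡ v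
∈⇒at {x ∷ xs} (here refl) = 1 , (s≤s z≤n , s≤s z≤n) , refl
∈⇒at {x ∷ xs} (there v∈) with ∈⇒at v∈
... | suc j , (_ , j≤) , eq = suc (suc j) , (s≤s z≤n , s≤s j≤) , eq

at-map : ∀ (g : ℕ → ℕ) (xs : List ℕ) j → InRange (length xs) j → at (map g xs) j ≡ g (at xs j)
at-map g (x ∷ xs) 1 _ = refl
at-map g (x ∷ xs) (suc (suc j)) (_ , s≤s j≤) = at-map g xs (suc j) (s≤s z≤n , j≤)

at-applyUpTo : ∀ (g : ℕ → ℕ) n j → j < n → at (applyUpTo g n) (suc j) ≡ g j
at-applyUpTo g (suc n) zero _ = refl
at-applyUpTo g (suc n) (suc j) (s≤s j<n) = at-applyUpTo (λ k → g (suc k)) n j j<n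

at-upTo : ∀ n j → InRange n j → at (applyUpTo suc n) j ≡ j
at-upTo n (suc j) (_ , j<n) = at-applyUpTo suc n j j<n

at-map-upTo : ∀ (g : ℕ → ℕ) n j → InRange n j → at (map g (applyUpTo suc n)) j ≡ g j
at-map-upTo g n j j∈ =
  trans (at-map g (applyUpTo suc n) j (proj₁ j∈ , subst (j ≤_) (sym (length-applyUpTo suc n)) (proj₂ j∈)))
        (cong g (at-upTo n j j∈))

at-sorted : ∀ {xs : List ℕ} → AllPairs _<_ xs → ∀ a b → 1 ≤ a → a < b → b ≤ length xs → at xs a < at xs b
at-sorted {x ∷ xs} (x< ∷ _) 1 (suc (suc b)) _ _ (s≤s b≤) = All.lookup x< (at-∈ xs (suc b) (s≤s z≤n , b≤))
at-sorted {x ∷ xs} (_ ∷ _) 1 1 _ (s≤s ()) _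
at-sorted {x ∷ xs} (_ ∷ xs<) (suc (suc a)) (suc (suc b)) _ (s≤s a<b) (s≤s b≤) =
  at-sorted xs< (suc a) (suc b) (s≤s z≤n) a<b b≤

at-injective : ∀ {xs : List ℕ} → Unique xs → ∀ a b → InRange (length xs) a → InRange (length xs) b →
  at xs a ≡ at xs b → a ≡ b
at-injective {x ∷ xs} _ 1 1 _ _ _ = refl
at-injective {x ∷ xs} (x∉ ∷ _) 1 (suc (suc b)) _ (_ , s≤s b≤) eq =
  ⊥-elim (All.lookup x∉ (at-∈ xs (suc b) (s≤s z≤n , b≤)) eq)
at-injective {x ∷ xs} (x∉ ∷ _) (suc (suc a)) 1 (_ , s≤s a≤) _ eq =
  ⊥-elim (All.lookup x∉ (at-∈ xs (suc a) (s≤s z≤n , a≤)) (sym eq))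
at-injective {x ∷ xs} (_ ∷ xs!) (suc (suc a)) (suc (suc b)) (_ , s≤s a≤) (_ , s≤s b≤) eq =
  cong suc (at-injective xs! (suc a) (suc b) (s≤s z≤n , a≤) (s≤s z≤n , b≤) eq)

at-idx : ∀ {xs : List ℕ} {v} → v ∈ xs → InRange (length xs) (idx v xs) × at xs (idx v xs) ≡ v
at-idx {x ∷ xs} {v} v∈ with x ≡ᵇ v in eq
... | true = (s≤s z≤n , s≤s z≤n) , ≡ᵇ⇒≡ x v (subst T (sym eq) tt)
at-idx {x ∷ xs} (here refl) | false = ⊥-elim (subst T eq (≡⇒≡ᵇ x x refl))
at-idx {x ∷ xs} (there v∈) | false with at-idx v∈
... | (1≤ , ≤len) , at≡ = (s≤s z≤n , s≤s ≤len) , trans (at-∷ x xs _ 1≤) at≡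

length-ins : ∀ k x (ys : List ℕ) → k ≤ length ys → length (ins k x ys) ≡ suc (length ys)
length-ins zero x ys _ = refl
length-ins (suc k) x (y ∷ ys) (s≤s k≤) = cong suc (length-ins k x ys k≤)

at-ins : ∀ k x (ys : List ℕ) → k ≤ length ys → at (ins k x ys) (suc k) ≡ x
at-ins zero x ys _ = refl
at-ins (suc k) x (y ∷ ys) (s≤s k≤) = at-ins k x ys k≤

at-ins-before : ∀ k x (ys : List ℕ) u → 1 ≤ u → u ≤ k → u ≤ length ys → at (ins k x ys) u ≡ at ys u
at-ins-before (suc k) x (y ∷ ys) 1 _ _ _ = refl
at-ins-before (suc (suc k)) x (y ∷ ys) (suc (suc u)) _ (s≤s u≤k) (s≤s u≤) =
  at-ins-before (suc k) x ys (suc u) (s≤s z≤n) u≤k u≤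

at-ins-after : ∀ k x (ys : List ℕ) u → k < u → at (ins k x ys) (suc u) ≡ at ys u
at-ins-after zero x [] (suc u) _ = refl
at-ins-after zero x (y ∷ ys) (suc u) _ = refl
at-ins-after (suc k) x [] 1 (s≤s ())
at-ins-after (suc k) x [] (suc (suc u)) _ = refl
at-ins-after (suc k) x (y ∷ ys) (suc (suc u)) (s≤s k<u) = at-ins-after k x ys (suc u) k<u

lex-< : ∀ {M a b c d} → b < M → a < c → a * M + b < c * M + d
lex-< {M} {a} {b} {c} {d} b<M a<c = begin-strict
  a * M + b <⟨ +-monoʳ-< (a * M) b<M ⟩
  a * M + M ≡⟨ +-comm (a * M) M ⟩
  suc a * M ≤⟨ *-monoˡ-≤ M a<c ⟩
  c * M     ≤⟨ m≤m+n (c * M) d ⟩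
  c * M + d ∎
  where open ≤-Reasoning

lex-<-≡ : ∀ {M a b c d} → a ≡ c → b < d → a * M + b < c * M + d
lex-<-≡ {M} {a} refl b<d = +-monoʳ-< (a * M) b<d

nth : List A → ℕ → A → A
nth [] i d = d
nth (x ∷ xs) zero d = x
nth (x ∷ xs) (suc i) d = nth xs i d

nth-∈ : ∀ {xs : List A} {i d} → i < length xs → nth xs i d ∈ xs
nth-∈ {xs = x ∷ xs} {zero} _ = here refl
nth-∈ {xs = x ∷ xs} {suc i} (s≤s i<) = there (nth-∈ i<)

nth-All : ∀ {P : A → Set} {xs : List A} {i d} → All P xs → i < length xs → P (nth xs i d)
nth-All {xs = x ∷ xs} {zero} (px ∷ _) _ = px
nth-All {xs = x ∷ xs} {suc i} (_ ∷ pxs) (s≤s i<) = nth-All pxs i<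

nth-AllPairs : ∀ {R : A → A → Set} {xs : List A} {i j d} → AllPairs R xs → i < j → j < length xs →
  R (nth xs i d) (nth xs j d)
nth-AllPairs {xs = x ∷ xs} {zero} {suc j} (x~ ∷ _) _ (s≤s j<) = All.lookup x~ (nth-∈ j<)
nth-AllPairs {xs = x ∷ xs} {suc i} {suc j} (_ ∷ xs~) (s≤s i<j) (s≤s j<) = nth-AllPairs xs~ i<j j<

nth-map : ∀ (g : A → B) (xs : List A) i {d} → i < length xs → nth (map g xs) i (g d) ≡ g (nth xs i d)
nth-map g (x ∷ xs) zero _ = refl
nth-map g (x ∷ xs) (suc i) (s≤s i<) = nth-map g xs i i<

Pointwise-tabulate : ∀ {R : A → B → Set} (xs : List A) (ys : List B) {dx dy} →
  length xs ≡ length ys → (∀ i → i < length xs → R (nth xs i dx) (nth ys i dy)) → Pointwise R xs ys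
Pointwise-tabulate [] [] _ _ = []
Pointwise-tabulate (x ∷ xs) (y ∷ ys) len R-nth =
  R-nth 0 (s≤s z≤n) ∷ Pointwise-tabulate xs ys (suc-injective len) (λ i i< → R-nth (suc i) (s≤s i<))

nth≤sum : ∀ (xs : List ℕ) i → nth xs i 0 ≤ sum xs
nth≤sum [] i = z≤n
nth≤sum (x ∷ xs) zero = m≤m+n x _
nth≤sum (x ∷ xs) (suc i) = ≤-trans (nth≤sum xs i) (m≤n+m _ x)

-- Ranking by a numeric key

count : (A → Bool) → List A → ℕ
count p xs = length (filterᵇ p xs)

count-mono : ∀ (p q : A → Bool) ys → (∀ {y} → y ∈ ys → T (p y) → T (q y)) → count p ys ≤ count q ys
count-mono p q [] _ = z≤n
count-mono p q (y ∷ ys) p⇒q with count-mono p q ys (λ y∈ → p⇒q (there y∈)) | p y in py | q y in qy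
... | rest | true  | true  = s≤s rest
... | rest | true  | false = ⊥-elim (subst T qy (p⇒q (here refl) (subst T (sym py) tt)))
... | rest | false | true  = m≤n⇒m≤1+n rest
... | rest | false | false = rest

count-mono-< : ∀ (p q : A → Bool) ys → (∀ {y} → y ∈ ys → T (p y) → T (q y)) →
  ∀ {z} → z ∈ ys → ¬ T (p z) → T (q z) → count p ys < count q ys
count-mono-< p q (y ∷ ys) p⇒q (here refl) ¬pz qz
  with count-mono p q ys (λ y∈ → p⇒q (there y∈)) | p y in py | q y in qy
... | rest | true  | _     = ⊥-elim (¬pz tt)
... | rest | false | true  = s≤s rest
... | rest | false | false = ⊥-elim qz
count-mono-< p q (y ∷ ys) p⇒q (there z∈) ¬pz qz
  with count-mono-< p q ys (λ y∈ → p⇒q (there y∈)) z∈ ¬pz qz | p y in py | q y in qy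
... | rest | true  | true  = s≤s rest
... | rest | true  | false = ⊥-elim (subst T qy (p⇒q (here refl) (subst T (sym py) tt)))
... | rest | false | true  = m<n⇒m<1+n rest
... | rest | false | false = rest

count≤length : ∀ (p : A → Bool) ys → count p ys ≤ length ys
count≤length p ys = length-filter (λ y → T? (p y)) ys

count-all : ∀ (p : A → Bool) ys → (∀ {y} → y ∈ ys → T (p y)) → count p ys ≡ length ys
count-all p ys all = cong length (filter-all (λ y → T? (p y)) (All.tabulate all))

first : (A → Bool) → A → List A → A
first p d [] = d
first p d (x ∷ xs) = if p x then x else first p d xs

first-spec : ∀ (p : A → Bool) d xs {y} → y ∈ xs → T (p y) → first p d xs ∈ xs × T (p (first p d xs))
first-spec p d (x ∷ xs) {y} y∈ py with p x in px
... | true = here refl , subst T (sym px) tt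
first-spec p d (x ∷ xs) (here refl) py | false = ⊥-elim (subst T px py)
first-spec p d (x ∷ xs) (there y∈) py | false with first-spec p d xs y∈ py
... | f∈ , pf = there f∈ , pf

map-unique-on : ∀ (g : A → B) {xs : List A} → Unique xs →
  (∀ {x y} → x ∈ xs → y ∈ xs → g x ≡ g y → x ≡ y) → Unique (map g xs)
map-unique-on g {[]} _ _ = []
map-unique-on g {x ∷ xs} (x∉ ∷ xs!) g-inj =
  All.tabulate gx∉ ∷ map-unique-on g xs! (λ x∈ y∈ → g-inj (there x∈) (there y∈))
  where
  gx∉ : ∀ {v} → v ∈ map g xs → g x ≢ v
  gx∉ v∈ gx≡v with ∈-map⁻ g v∈
  ... | y , y∈ , refl = All.lookup x∉ y∈ (g-inj (here refl) (there y∈) gx≡v)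

module Ranking {A : Set} (E : List A) (E! : Unique E) (key : A → ℕ) (_⊏_ : A → A → Set)
  (⊏⇒key< : ∀ {x y} → x ∈ E → y ∈ E → x ⊏ y → key x < key y)
  (⊏-trichotomous : ∀ {x y} → x ∈ E → y ∈ E → x ⊏ y ⊎ x ≡ y ⊎ y ⊏ x)
  (default : A) where

  rank : A → ℕ
  rank x = count (λ y → key y ≤ᵇ key x) E

  rank-inRange : ∀ {x} → x ∈ E → InRange (length E) (rank x)
  rank-inRange {x} x∈ =
    ≤-trans (s≤s z≤n) (count-mono-< (λ _ → false) _ E (λ _ ()) x∈ (λ ()) (≤⇒≤ᵇ (≤-refl {key x}))) ,
    count≤length _ E

  key<⇒rank< : ∀ {x y} → y ∈ E → key x < key y → rank x < rank y
  key<⇒rank< {x} {y} y∈ kx<ky = count-mono-< _ _ E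
    (λ {z} _ kz≤kx → ≤⇒≤ᵇ (≤-trans (≤ᵇ⇒≤ (key z) (key x) kz≤kx) (<⇒≤ kx<ky))) y∈
    (λ ky≤kx → <⇒≱ kx<ky (≤ᵇ⇒≤ (key y) (key x) ky≤kx)) (≤⇒≤ᵇ (≤-refl {key y}))

  rank-mono : ∀ {x y} → x ∈ E → y ∈ E → x ⊏ y → rank x < rank y
  rank-mono x∈ y∈ x⊏y = key<⇒rank< y∈ (⊏⇒key< x∈ y∈ x⊏y)

  rank-reflects : ∀ {x y} → x ∈ E → y ∈ E → rank x < rank y → x ⊏ y
  rank-reflects x∈ y∈ rx<ry with ⊏-trichotomous x∈ y∈
  ... | inj₁ x⊏y = x⊏y
  ... | inj₂ (inj₁ refl) = ⊥-elim (<-irrefl refl rx<ry)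
  ... | inj₂ (inj₂ y⊏x) = ⊥-elim (<-asym rx<ry (rank-mono y∈ x∈ y⊏x))

  rank-injective : ∀ {x y} → x ∈ E → y ∈ E → rank x ≡ rank y → x ≡ y
  rank-injective x∈ y∈ rx≡ry with ⊏-trichotomous x∈ y∈
  ... | inj₁ x⊏y = ⊥-elim (<-irrefl rx≡ry (rank-mono x∈ y∈ x⊏y))
  ... | inj₂ (inj₁ x≡y) = x≡y
  ... | inj₂ (inj₂ y⊏x) = ⊥-elim (<-irrefl (sym rx≡ry) (rank-mono y∈ x∈ y⊏x))

  rank-maximum : ∀ {x} → x ∈ E → (∀ {y} → y ∈ E → ¬ x ⊏ y) → rank x ≡ length E
  rank-maximum {x} x∈ x-max = count-all _ E ky≤kx
    where
    ky≤kx : ∀ {y} → y ∈ E → T (key y ≤ᵇ key x)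
    ky≤kx y∈ with ⊏-trichotomous y∈ x∈
    ... | inj₁ y⊏x = ≤⇒≤ᵇ (<⇒≤ (⊏⇒key< y∈ x∈ y⊏x))
    ... | inj₂ (inj₁ refl) = ≤⇒≤ᵇ (≤-refl {key x})
    ... | inj₂ (inj₂ x⊏y) = ⊥-elim (x-max y∈ x⊏y)

  map-rank-↭ : map rank E ↭ applyUpTo suc (length E)
  map-rank-↭ = unique-inRange⇒↭upTo (map-unique-on rank E! rank-injective) rank∈ (length-map rank E)
    where
    rank∈ : ∀ {v} → v ∈ map rank E → InRange (length E) v
    rank∈ v∈ with ∈-map⁻ rank v∈
    ... | x , x∈ , refl = rank-inRange x∈

  unrank : ℕ → A
  unrank j = first (λ x → rank x ≡ᵇ j) default E

  unrank-spec : ∀ {j} → InRange (length E) j → unrank j ∈ E × rank (unrank j) ≡ j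
  unrank-spec {j} j∈ with ∈-map⁻ rank (∈-resp-↭ (↭-sym map-rank-↭) (∈-upTo⁺ j∈))
  ... | x , x∈ , j≡rx with first-spec (λ x → rank x ≡ᵇ j) default E x∈ (≡⇒≡ᵇ (rank x) j (sym j≡rx))
  ...   | u∈ , ru≡j = u∈ , ≡ᵇ⇒≡ _ j ru≡j

  unrank-rank : ∀ {x} → x ∈ E → unrank (rank x) ≡ x
  unrank-rank x∈ with unrank-spec (rank-inRange x∈)
  ... | u∈ , ru≡rx = rank-injective u∈ x∈ ru≡rx

-- Kernel permutations

Occ132-inRange : ∀ π {i j k} → Occ132 π i j k →
  InRange (length π) i × InRange (length π) j × InRange (length π) k
Occ132-inRange π (1≤i , i<j , j<k , k≤n , _) =
  (1≤i , <⇒≤ (<-trans i<j (<-≤-trans j<k k≤n))) ,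
  (≤-trans 1≤i (<⇒≤ i<j) , <⇒≤ (<-≤-trans j<k k≤n)) ,
  (≤-trans 1≤i (<⇒≤ (<-trans i<j j<k)) , k≤n)

Member-inRange : ∀ π {p i j k} → Occ132 π i j k → Member p i j k → InRange (length π) p
Member-inRange π o (inj₁ refl) = proj₁ (Occ132-inRange π o)
Member-inRange π o (inj₂ (inj₁ refl)) = proj₁ (proj₂ (Occ132-inRange π o))
Member-inRange π o (inj₂ (inj₂ refl)) = proj₂ (proj₂ (Occ132-inRange π o))

Member-map : ∀ (g : ℕ → ℕ) {p i j k} → Member p i j k → Member (g p) (g i) (g j) (g k)
Member-map g (inj₁ refl) = inj₁ refl
Member-map g (inj₂ (inj₁ refl)) = inj₂ (inj₁ refl)
Member-map g (inj₂ (inj₂ refl)) = inj₂ (inj₂ refl)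

OrderIso-< : ∀ xs ys → OrderIso xs ys → ∀ {a b} → InRange (length xs) a → InRange (length xs) b →
  at xs a < at xs b ⇔ at ys a < at ys b
OrderIso-< xs ys iso {a} {b} (1≤a , a≤) (1≤b , b≤) = proj₂ iso a b 1≤a a≤ 1≤b b≤

OrderIso-tabulate : ∀ (g : ℕ → ℕ) k (ys : List ℕ) → length ys ≡ k →
  (∀ {a b} → InRange k a → InRange k b → g a < g b ⇔ at ys a < at ys b) →
  OrderIso (map g (applyUpTo suc k)) ys
OrderIso-tabulate g k ys len-ys g<⇔ = trans len-xs (sym len-ys) , λ a b 1≤a a≤ 1≤b b≤ →
  let a∈ = 1≤a , subst (a ≤_) len-xs a≤ ; b∈ = 1≤b , subst (b ≤_) len-xs b≤ in
  subst₂ (λ u v → (u < v) ⇔ (at ys a < at ys b)) (sym (at-map-upTo g k a a∈)) (sym (at-map-upTo g k b b∈))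
    (g<⇔ a∈ b∈)
  where
  len-xs : length (map g (applyUpTo suc k)) ≡ k
  len-xs = trans (length-map g (applyUpTo suc k)) (length-applyUpTo suc k)

record KernelConnected (ρ : List ℕ) : Set where
  field
    top : ℕ
    top∈ : InRange (length ρ) top
    at-top : at ρ top ≡ length ρ
    reaches-top : ∀ {t} → InRange (length ρ) t → Star (Adj ρ) (ent t) (ent top)

module _ {ρ : List ℕ} (kp : KernelPerm ρ) (1≤s : 1 ≤ length ρ) where

  private
    ρ-perm : IsPerm ρ
    ρ-perm = proj₁ kp

    π : List ℕ
    π = proj₁ (proj₂ kp)

    π-perm : IsPerm π
    π-perm = proj₁ (proj₂ (proj₂ kp))

    is : List ℕ
    is = proj₁ (proj₂ (proj₂ (proj₂ kp)))

    is-sorted : AllPairs _<_ is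
    is-sorted = proj₁ (proj₁ (proj₂ (proj₂ (proj₂ (proj₂ kp)))))

    is-kernel : ∀ p → (p ∈ is) ⇔ InKernel π p
    is-kernel = proj₂ (proj₁ (proj₂ (proj₂ (proj₂ (proj₂ kp)))))

    iso : OrderIso (map (at π) is) ρ
    iso = proj₂ (proj₂ (proj₂ (proj₂ (proj₂ kp))))

    s = length ρ

    len-is : length is ≡ s
    len-is = trans (sym (length-map (at π) is)) (proj₁ iso)

    InRange-is : ∀ {t} → InRange s t → InRange (length is) t
    InRange-is (1≤t , t≤s) = 1≤t , subst (_ ≤_) (sym len-is) t≤s

    kernel⇒∈ : ∀ {p} → InKernel π p → p ∈ is
    kernel⇒∈ = Equivalence.from (is-kernel _)

    ∈⇒kernel : ∀ {p} → p ∈ is → InKernel π p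
    ∈⇒kernel = Equivalence.to (is-kernel _)

    kernel-inRange : ∀ {p} → p ∈ is → InRange (length π) p
    kernel-inRange p∈ with 1≤p , p≤n , _ ← ∈⇒kernel p∈ = 1≤p , p≤n

    ix : ℕ → ℕ
    ix p = idx p is

    ix-inRange : ∀ {p} → p ∈ is → InRange s (ix p)
    ix-inRange p∈ with (1≤ , ≤len) , _ ← at-idx p∈ = 1≤ , subst (_ ≤_) len-is ≤len

    at-ix : ∀ {p} → p ∈ is → at is (ix p) ≡ p
    at-ix p∈ = proj₂ (at-idx p∈)

    ix-mono : ∀ {p p'} → p ∈ is → p' ∈ is → p < p' → ix p < ix p'
    ix-mono {p} {p'} p∈ p'∈ p<p' with <-cmp (ix p) (ix p')
    ... | tri< lt _ _ = lt
    ... | tri≈ _ eq _ = ⊥-elim (<-irrefl (trans (sym (at-ix p∈)) (trans (cong (at is) eq) (at-ix p'∈))) p<p')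
    ... | tri> _ _ gt = ⊥-elim (<-asym p<p' (subst₂ _<_ (at-ix p'∈) (at-ix p∈)
            (at-sorted is-sorted (ix p') (ix p) (proj₁ (ix-inRange p'∈)) gt (proj₂ (InRange-is (ix-inRange p∈))))))

    kernel-value : ∀ {t} → InRange s t → at (map (at π) is) t ≡ at π (at is t)
    kernel-value t∈ = at-map (at π) is _ (InRange-is t∈)

    kernel<⇔ρ< : ∀ {a b} → InRange s a → InRange s b → at π (at is a) < at π (at is b) ⇔ at ρ a < at ρ b
    kernel<⇔ρ< a∈ b∈ =
      mk⇔ (λ lt → Equivalence.to iff (subst₂ _<_ (sym (kernel-value a∈)) (sym (kernel-value b∈)) lt))
          (λ lt → subst₂ _<_ (kernel-value a∈) (kernel-value b∈) (Equivalence.from iff lt))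
      where
      lift : ∀ {t} → InRange s t → InRange (length (map (at π) is)) t
      lift (1≤t , t≤s) = 1≤t , subst (_ ≤_) (sym (proj₁ iso)) t≤s
      iff = OrderIso-< (map (at π) is) ρ iso (lift a∈) (lift b∈)

    occ-to-ρ : ∀ {i j k} → i ∈ is × j ∈ is × k ∈ is → Occ132 π i j k → Occ132 ρ (ix i) (ix j) (ix k)
    occ-to-ρ (i∈ , j∈ , k∈) (_ , i<j , j<k , _ , πi<πk , πk<πj) =
      proj₁ (ix-inRange i∈) , ix-mono i∈ j∈ i<j , ix-mono j∈ k∈ j<k , proj₂ (ix-inRange k∈) ,
      Equivalence.to (kernel<⇔ρ< (ix-inRange i∈) (ix-inRange k∈))
        (subst₂ (λ u v → at π u < at π v) (sym (at-ix i∈)) (sym (at-ix k∈)) πi<πk) ,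
      Equivalence.to (kernel<⇔ρ< (ix-inRange k∈) (ix-inRange j∈))
        (subst₂ (λ u v → at π u < at π v) (sym (at-ix k∈)) (sym (at-ix j∈)) πk<πj)

    first-kernel : InKernel π (at is 1)
    first-kernel = ∈⇒kernel (at-∈ is 1 (InRange-is (≤-refl , 1≤s)))

    q : ℕ
    q = proj₁ (proj₂ (proj₂ first-kernel))

    q∈π : InRange (length π) q
    q∈π = proj₁ (proj₂ (proj₂ (proj₂ first-kernel))) , proj₁ (proj₂ (proj₂ (proj₂ (proj₂ first-kernel))))

    at-q : at π q ≡ length π
    at-q = proj₁ (proj₂ (proj₂ (proj₂ (proj₂ (proj₂ first-kernel)))))

    reach-q⇒∈ : ∀ {p} → InRange (length π) p → Star (Adj π) (ent p) (ent q) → p ∈ is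
    reach-q⇒∈ (1≤p , p≤n) path = kernel⇒∈ (1≤p , p≤n , q , proj₁ q∈π , proj₂ q∈π , at-q , path)

    q∈is : q ∈ is
    q∈is = reach-q⇒∈ q∈π ε

    occ-reach-q⇒∈ : ∀ {i j k} → Occ132 π i j k → Star (Adj π) (occ i j k) (ent q) → i ∈ is × j ∈ is × k ∈ is
    occ-reach-q⇒∈ o path =
      reach-q⇒∈ (Member-inRange π o m₁) (e-o o m₁ ◅ path) ,
      reach-q⇒∈ (Member-inRange π o m₂) (e-o o m₂ ◅ path) ,
      reach-q⇒∈ (Member-inRange π o m₃) (e-o o m₃ ◅ path)
      where
      m₁ = inj₁ refl
      m₂ = inj₂ (inj₁ refl)
      m₃ = inj₂ (inj₂ refl)

    image : Vtx → Vtx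
    image (ent p) = ent (ix p)
    image (occ i j k) = occ (ix i) (ix j) (ix k)

    transport : ∀ {u} → Star (Adj π) u (ent q) → Star (Adj ρ) (image u) (ent (ix q))
    transport ε = ε
    transport (e-o o m ◅ path) = e-o (occ-to-ρ (occ-reach-q⇒∈ o path) o) (Member-map ix m) ◅ transport path
    transport (o-e o m ◅ path) =
      o-e (occ-to-ρ (occ-reach-q⇒∈ o (o-e o m ◅ path)) o) (Member-map ix m) ◅ transport path

    at-ix-q : at ρ (ix q) ≡ s
    at-ix-q with ∈⇒at (inRange⇒∈IsPerm ρ-perm (1≤s , ≤-refl))
    ... | t , t∈ , ρt≡s with at ρ (ix q) <? at ρ t
    ...   | no ρq≮ρt = ≤-antisym (proj₂ (IsPerm⇒inRange ρ-perm (at-∈ ρ (ix q) (ix-inRange q∈is))))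
                                  (subst (_≤ at ρ (ix q)) ρt≡s (≮⇒≥ ρq≮ρt))
    ...   | yes ρq<ρt = ⊥-elim (<⇒≱ (Equivalence.from (kernel<⇔ρ< (ix-inRange q∈is) t∈) ρq<ρt) πt≤πq)
      where
      πt≤πq : at π (at is t) ≤ at π (at is (ix q))
      πt≤πq = subst (at π (at is t) ≤_) (trans (sym at-q) (cong (at π) (sym (at-ix q∈is))))
        (proj₂ (IsPerm⇒inRange π-perm (at-∈ π _ (kernel-inRange (at-∈ is t (InRange-is t∈))))))

    reaches-ix-q : ∀ {t} → InRange s t → Star (Adj ρ) (ent t) (ent (ix q))
    reaches-ix-q {t} t∈ with ∈⇒kernel (at-∈ is t (InRange-is t∈))
    ... | 1≤p , p≤n , q' , 1≤q' , q'≤n , at-q' , path =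
      subst (λ u → Star (Adj ρ) (ent u) (ent (ix q))) ix-p≡t (transport (subst (λ u → Star (Adj π) _ (ent u)) q'≡q path))
      where
      q'≡q : q' ≡ q
      q'≡q = at-injective (IsPerm⇒unique π-perm) q' q (1≤q' , q'≤n) q∈π (trans at-q' (sym at-q))
      ix-p≡t : ix (at is t) ≡ t
      ix-p≡t = at-injective (sorted⇒unique is-sorted) _ t (InRange-is (ix-inRange p∈)) (InRange-is t∈) (at-ix p∈)
        where
        p∈ = at-∈ is t (InRange-is t∈)

  kernelPerm-connected : KernelConnected ρ
  kernelPerm-connected = record
    { top = ix q ; top∈ = ix-inRange q∈is ; at-top = at-ix-q ; reaches-top = reaches-ix-q }

-- Feasible cells

m<n⇒2m<2n∸1 : ∀ {m n} → m < n → 2 * m < 2 * n ∸ 1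
m<n⇒2m<2n∸1 {m} {suc n} (s≤s m≤n) = subst (2 * m <_) (sym (+-suc n (n + 0))) (s≤s (*-monoʳ-≤ 2 m≤n))

m≤n⇒2m∸1<2n : ∀ {m n} → 1 ≤ m → m ≤ n → 2 * m ∸ 1 < 2 * n
m≤n⇒2m∸1<2n {suc m} _ m≤n = <-≤-trans (n<1+n _) (*-monoʳ-≤ 2 m≤n)

module Insertion (ρ : List ℕ) {m l : ℕ} (1≤m : 1 ≤ m) (1≤l : 1 ≤ l) (l≤ : l ≤ suc (length ρ)) where

  private
    s = length ρ

    τ : List ℕ
    τ = ins (l ∸ 1) (2 * m ∸ 1) (map (2 *_) ρ)

    l-1≤ : l ∸ 1 ≤ length (map (2 *_) ρ)
    l-1≤ = subst (l ∸ 1 ≤_) (sym (length-map (2 *_) ρ)) (∸-monoˡ-≤ 1 l≤)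

    suc[l-1] : suc (l ∸ 1) ≡ l
    suc[l-1] = trans (+-comm 1 (l ∸ 1)) (m∸n+n≡m 1≤l)

    length-τ : length τ ≡ suc s
    length-τ = trans (length-ins (l ∸ 1) _ (map (2 *_) ρ) l-1≤) (cong suc (length-map (2 *_) ρ))

    τ-at-l : at τ l ≡ 2 * m ∸ 1
    τ-at-l = subst (λ z → at τ z ≡ 2 * m ∸ 1) suc[l-1] (at-ins (l ∸ 1) _ (map (2 *_) ρ) l-1≤)

    τ-before : ∀ {u} → 1 ≤ u → u < l → u ≤ s → at τ u ≡ 2 * at ρ u
    τ-before {u} 1≤u u<l u≤s =
      trans (at-ins-before (l ∸ 1) _ (map (2 *_) ρ) u 1≤u (<⇒≤pred u<l) (subst (u ≤_) (sym (length-map (2 *_) ρ)) u≤s))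
            (at-map (2 *_) ρ u (1≤u , u≤s))

    τ-after : ∀ {u} → l ≤ u → u ≤ s → at τ (suc u) ≡ 2 * at ρ u
    τ-after {u} l≤u u≤s =
      trans (at-ins-after (l ∸ 1) _ (map (2 *_) ρ) u (<-≤-trans (subst (l ∸ 1 <_) suc[l-1] ≤-refl) l≤u))
            (at-map (2 *_) ρ u (≤-trans 1≤l l≤u , u≤s))

    below : ∀ {x} → x < m → 2 * x < 2 * m ∸ 1
    below = m<n⇒2m<2n∸1

    above : ∀ {x} → m ≤ x → 2 * m ∸ 1 < 2 * x
    above = m≤n⇒2m∸1<2n 1≤m

  -- The inserted entry m - ½ plays the role of the 2, the 3 or the 1 of an occurrence of 132.
  infeasible-as-2 : ∀ {t₁ t₂} → 1 ≤ t₁ → t₁ < t₂ → t₂ < l → at ρ t₁ < m → m ≤ at ρ t₂ → Infeasible ρ (m , l)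
  infeasible-as-2 {t₁} {t₂} 1≤t₁ t₁<t₂ t₂<l ρ₁<m m≤ρ₂ = t₁ , t₂ , l ,
    (1≤t₁ , t₁<t₂ , t₂<l , subst (l ≤_) (sym length-τ) l≤ ,
     subst₂ _<_ (sym (τ-before 1≤t₁ (<-trans t₁<t₂ t₂<l) t₁≤s)) (sym τ-at-l) (below ρ₁<m) ,
     subst₂ _<_ (sym τ-at-l) (sym (τ-before (≤-trans 1≤t₁ (<⇒≤ t₁<t₂)) t₂<l t₂≤s)) (above m≤ρ₂)) ,
    inj₂ (inj₂ refl)
    where
    t₂≤s : t₂ ≤ s
    t₂≤s = ≤-pred (<-≤-trans t₂<l l≤)
    t₁≤s : t₁ ≤ s
    t₁≤s = ≤-trans (<⇒≤ t₁<t₂) t₂≤s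

  infeasible-as-3 : ∀ {t₁ t₃} → 1 ≤ t₁ → t₁ < l → l ≤ t₃ → t₃ ≤ s → at ρ t₁ < at ρ t₃ → at ρ t₃ < m →
    Infeasible ρ (m , l)
  infeasible-as-3 {t₁} {t₃} 1≤t₁ t₁<l l≤t₃ t₃≤s ρ₁<ρ₃ ρ₃<m = t₁ , l , suc t₃ ,
    (1≤t₁ , t₁<l , s≤s l≤t₃ , subst (suc t₃ ≤_) (sym length-τ) (s≤s t₃≤s) ,
     subst₂ _<_ (sym (τ-before 1≤t₁ t₁<l (≤-trans (<⇒≤ t₁<l) (≤-trans l≤t₃ t₃≤s)))) (sym (τ-after l≤t₃ t₃≤s))
       (*-monoʳ-< 2 ρ₁<ρ₃) ,
     subst₂ _<_ (sym (τ-after l≤t₃ t₃≤s)) (sym τ-at-l) (below ρ₃<m)) ,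
    inj₂ (inj₁ refl)

  infeasible-as-1 : ∀ {t₂ t₃} → l ≤ t₂ → t₂ < t₃ → t₃ ≤ s → m ≤ at ρ t₃ → at ρ t₃ < at ρ t₂ →
    Infeasible ρ (m , l)
  infeasible-as-1 {t₂} {t₃} l≤t₂ t₂<t₃ t₃≤s m≤ρ₃ ρ₃<ρ₂ = l , suc t₂ , suc t₃ ,
    (1≤l , s≤s l≤t₂ , s≤s t₂<t₃ , subst (suc t₃ ≤_) (sym length-τ) (s≤s t₃≤s) ,
     subst₂ _<_ (sym τ-at-l) (sym (τ-after (≤-trans l≤t₂ (<⇒≤ t₂<t₃)) t₃≤s)) (above m≤ρ₃) ,
     subst₂ _<_ (sym (τ-after (≤-trans l≤t₂ (<⇒≤ t₂<t₃)) t₃≤s)) (sym (τ-after l≤t₂ (≤-trans (<⇒≤ t₂<t₃) t₃≤s)))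
       (*-monoʳ-< 2 ρ₃<ρ₂)) ,
    inj₁ refl

module _ {ρ : List ℕ} (conn : KernelConnected ρ) {m l : ℕ} (feasible : Feasible ρ (m , l)) where

  open KernelConnected conn

  private
    s = length ρ
    1≤m = proj₁ feasible
    m≤s = proj₁ (proj₂ feasible)
    1≤l = proj₁ (proj₂ (proj₂ feasible))
    l≤ = proj₁ (proj₂ (proj₂ (proj₂ feasible)))
    ¬infeasible = proj₂ (proj₂ (proj₂ (proj₂ feasible)))

    open Insertion ρ 1≤m 1≤l l≤

    SouthWest : ℕ → Set
    SouthWest t = InRange s t × t < l × at ρ t < m

    SouthWestᵛ : Vtx → Set
    SouthWestᵛ (ent t) = SouthWest t
    SouthWestᵛ (occ i j k) = SouthWest i × SouthWest j × SouthWest k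

    module _ {i j k} (o : Occ132 ρ i j k) where
      i∈ = proj₁ (Occ132-inRange ρ o)
      j∈ = proj₁ (proj₂ (Occ132-inRange ρ o))
      k∈ = proj₂ (proj₂ (Occ132-inRange ρ o))
      1≤i = proj₁ o
      i<j = proj₁ (proj₂ o)
      j<k = proj₁ (proj₂ (proj₂ o))
      k≤s = proj₁ (proj₂ (proj₂ (proj₂ o)))
      ρi<ρk = proj₁ (proj₂ (proj₂ (proj₂ (proj₂ o))))
      ρk<ρj = proj₂ (proj₂ (proj₂ (proj₂ (proj₂ o))))

      southWest-via-k : SouthWest k → SouthWestᵛ (occ i j k)
      southWest-via-k (_ , k<l , ρk<m) with at ρ j <? m
      ... | yes ρj<m = (i∈ , <-trans i<j (<-trans j<k k<l) , <-trans ρi<ρk ρk<m) , (j∈ , <-trans j<k k<l , ρj<m) ,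
                       (k∈ , k<l , ρk<m)
      ... | no ρj≮m = ⊥-elim (¬infeasible (infeasible-as-2 1≤i i<j (<-trans j<k k<l) (<-trans ρi<ρk ρk<m) (≮⇒≥ ρj≮m)))

      southWest-via-j : SouthWest j → SouthWestᵛ (occ i j k)
      southWest-via-j (_ , j<l , ρj<m) with k <? l
      ... | yes k<l = southWest-via-k (k∈ , k<l , <-trans ρk<ρj ρj<m)
      ... | no k≮l = ⊥-elim (¬infeasible (infeasible-as-3 1≤i (<-trans i<j j<l) (≮⇒≥ k≮l) k≤s ρi<ρk (<-trans ρk<ρj ρj<m)))

      southWest-via-i : SouthWest i → SouthWestᵛ (occ i j k)
      southWest-via-i (_ , i<l , ρi<m) with j <? l | at ρ j <? m | at ρ k <? m
      ... | yes j<l | yes ρj<m | _ = southWest-via-j (j∈ , j<l , ρj<m)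
      ... | yes j<l | no ρj≮m | _ = ⊥-elim (¬infeasible (infeasible-as-2 1≤i i<j j<l ρi<m (≮⇒≥ ρj≮m)))
      ... | no j≮l | _ | yes ρk<m =
        ⊥-elim (¬infeasible (infeasible-as-3 1≤i i<l (≤-trans (≮⇒≥ j≮l) (<⇒≤ j<k)) k≤s ρi<ρk ρk<m))
      ... | no j≮l | _ | no ρk≮m = ⊥-elim (¬infeasible (infeasible-as-1 (≮⇒≥ j≮l) j<k k≤s (≮⇒≥ ρk≮m) ρk<ρj))

      southWest-occ : ∀ {p} → Member p i j k → SouthWest p → SouthWestᵛ (occ i j k)
      southWest-occ (inj₁ refl) = southWest-via-i
      southWest-occ (inj₂ (inj₁ refl)) = southWest-via-j
      southWest-occ (inj₂ (inj₂ refl)) = southWest-via-k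

    southWest-step : ∀ {u v} → Adj ρ u v → SouthWestᵛ u → SouthWestᵛ v
    southWest-step (e-o o p∈) sw = southWest-occ o p∈ sw
    southWest-step (o-e o (inj₁ refl)) (sw , _ , _) = sw
    southWest-step (o-e o (inj₂ (inj₁ refl))) (_ , sw , _) = sw
    southWest-step (o-e o (inj₂ (inj₂ refl))) (_ , _ , sw) = sw

    southWest-path : ∀ {u v} → Star (Adj ρ) u v → SouthWestᵛ u → SouthWestᵛ v
    southWest-path ε sw = sw
    southWest-path (e ◅ path) sw = southWest-path path (southWest-step e sw)

  -- Feasibility makes the entries south-west of the cell closed under 132-adjacency, and the
  -- maximum, which every entry reaches, is not south-west of it.
  feasible⇒southWest-empty : ∀ {t} → InRange s t → t < l → at ρ t < m → ⊥
  feasible⇒southWest-empty t∈ t<l ρt<m with _ , _ , ρtop<m ← southWest-path (reaches-top t∈) (t∈ , t<l , ρt<m) =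
    <⇒≱ ρtop<m (subst (m ≤_) (sym at-top) m≤s)

-- The construction

module Construction {ρ : List ℕ} (kp : KernelPerm ρ) (1≤s : 1 ≤ length ρ)
  (cs : List (ℕ × ℕ)) (cs-feasible : ∀ {c} → c ∈ cs → Feasible ρ c) (cs-sorted : AllPairs Prec cs)
  (αs : List (List ℕ)) (αs-perm : All IsPerm αs) (len-αs : length αs ≡ length cs) where

  conn : KernelConnected ρ
  conn = kernelPerm-connected kp 1≤s

  open KernelConnected conn

  s f : ℕ
  s = length ρ
  f = length cs

  cell : ℕ → ℕ × ℕ
  cell i = nth cs i (0 , 0)

  cm cl : ℕ → ℕ
  cm i = proj₁ (cell i)
  cl i = proj₂ (cell i)

  α : ℕ → List ℕ
  α i = nth αs i []

  a : ℕ → ℕ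
  a i = length (α i)

  module _ {i} (i<f : i < f) where

    cell-feasible : Feasible ρ (cell i)
    cell-feasible = cs-feasible (nth-∈ i<f)

    1≤cm : 1 ≤ cm i
    1≤cm = proj₁ cell-feasible

    cm≤s : cm i ≤ s
    cm≤s = proj₁ (proj₂ cell-feasible)

    1≤cl : 1 ≤ cl i
    1≤cl = proj₁ (proj₂ (proj₂ cell-feasible))

    cl≤1+s : cl i ≤ suc s
    cl≤1+s = proj₁ (proj₂ (proj₂ (proj₂ cell-feasible)))

    α-perm : IsPerm (α i)
    α-perm = nth-All αs-perm (subst (i <_) (sym len-αs) i<f)

  cm-antitone : ∀ {i j} → i ≤ j → j < f → cm j ≤ cm i
  cm-antitone i≤j j<f with m≤n⇒m<n∨m≡n i≤j
  ... | inj₁ i<j = proj₁ (proj₂ (nth-AllPairs cs-sorted i<j j<f))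
  ... | inj₂ refl = ≤-refl

  cl-monotone : ∀ {i j} → i ≤ j → j < f → cl i ≤ cl j
  cl-monotone i≤j j<f with m≤n⇒m<n∨m≡n i≤j
  ... | inj₁ i<j = proj₂ (proj₂ (nth-AllPairs cs-sorted i<j j<f))
  ... | inj₂ refl = ≤-refl

  cell-injective : ∀ {i j} → i < f → j < f → cm i ≡ cm j → cl i ≡ cl j → i ≡ j
  cell-injective {i} {j} i<f j<f cm≡ cl≡ with <-cmp i j
  ... | tri< i<j _ _ = ⊥-elim (proj₁ (nth-AllPairs cs-sorted i<j j<f) (cong₂ _,_ cm≡ cl≡))
  ... | tri≈ _ i≡j _ = i≡j
  ... | tri> _ _ j<i = ⊥-elim (proj₁ (nth-AllPairs cs-sorted j<i i<f) (cong₂ _,_ (sym cm≡) (sym cl≡)))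

  -- Cells later in ≺ lie weakly further right and lower, so ordering cell tokens by index (by
  -- reversed index for values) agrees with their placement next to the kernel tokens.
  data Token : Set where
    kernelTok : ℕ → Token
    cellTok : ℕ → ℕ → Token

  Valid : Token → Set
  Valid (kernelTok t) = InRange s t
  Valid (cellTok i r) = i < f × InRange (a i) r

  column row : Token → ℕ
  column (kernelTok t) = t
  column (cellTok i _) = cl i
  row (kernelTok t) = at ρ t
  row (cellTok i _) = cm i

  _⊏ₚ_ _⊏ᵥ_ : Token → Token → Set
  kernelTok t ⊏ₚ y = t < column y
  cellTok i r ⊏ₚ kernelTok t = cl i ≤ t
  cellTok i r ⊏ₚ cellTok i' r' = i < i' ⊎ (i ≡ i' × r < r')
  kernelTok t ⊏ᵥ y = at ρ t < row y
  cellTok i r ⊏ᵥ kernelTok t = cm i ≤ at ρ t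
  cellTok i r ⊏ᵥ cellTok i' r' = i' < i ⊎ (i ≡ i' × at (α i) r < at (α i) r')

  a≤Σa : ∀ i → a i ≤ sum (map length αs)
  a≤Σa i with i <? length αs
  ... | yes i< = subst (_≤ sum (map length αs)) (nth-map length αs i i<) (nth≤sum (map length αs) i)
  ... | no i≮ = subst (_≤ sum (map length αs)) (sym (a≡0 αs i (≮⇒≥ i≮))) z≤n
    where
    a≡0 : ∀ (xss : List (List ℕ)) i → length xss ≤ i → length (nth xss i []) ≡ 0
    a≡0 [] i _ = refl
    a≡0 (xs ∷ xss) (suc i) (s≤s len≤i) = a≡0 xss i len≤i

  -- Keys realising ⊏ₚ and ⊏ᵥ as lexicographic orders with digits below M.
  M′ M : ℕ
  M′ = suc (f + sum (map length αs))
  M = suc M′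

  posKey valKey : Token → ℕ
  posKey (kernelTok t) = (t * M + M′) * M + 0
  posKey (cellTok i r) = (cl i * M + i) * M + r
  valKey (kernelTok t) = (at ρ t * M + 0) * M + 0
  valKey (cellTok i r) = ((cm i ∸ 1) * M + (f ∸ i)) * M + at (α i) r

  private
    i<M′ : ∀ {i} → i < f → i < M′
    i<M′ i<f = ≤-trans i<f (m≤n⇒m≤1+n (m≤m+n _ _))

    r<M : ∀ {i r} → InRange (a i) r → r < M
    r<M {i} (_ , r≤a) = s≤s (≤-trans r≤a (≤-trans (a≤Σa i) (m≤n⇒m≤1+n (m≤n+m _ f))))

    f∸i<M : ∀ i → f ∸ i < M
    f∸i<M i = s≤s (≤-trans (m∸n≤m f i) (m≤n⇒m≤1+n (m≤m+n _ _)))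

    αr<M : ∀ {i r} → i < f → InRange (a i) r → at (α i) r < M
    αr<M i<f r∈ = r<M (IsPerm⇒inRange (α-perm i<f) (at-∈ _ _ r∈))

    0<M : 0 < M
    0<M = s≤s z≤n


  posKey-mono : ∀ {x y} → Valid x → Valid y → x ⊏ₚ y → posKey x < posKey y
  posKey-mono {kernelTok t} {kernelTok t'} _ _ t<t' = lex-< 0<M (lex-< ≤-refl t<t')
  posKey-mono {kernelTok t} {cellTok i r} _ _ t<cl = lex-< 0<M (lex-< ≤-refl t<cl)
  posKey-mono {cellTok i r} {kernelTok t} (i<f , r∈) _ cl≤t with m≤n⇒m<n∨m≡n cl≤t
  ... | inj₁ cl<t = lex-< (r<M r∈) (lex-< (≤-trans (i<M′ i<f) (n≤1+n _)) cl<t)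
  ... | inj₂ cl≡t = lex-< (r<M r∈) (lex-<-≡ cl≡t (i<M′ i<f))
  posKey-mono {cellTok i r} {cellTok i' r'} (i<f , r∈) (i'<f , _) (inj₁ i<i') with m≤n⇒m<n∨m≡n (cl-monotone (<⇒≤ i<i') i'<f)
  ... | inj₁ cl<cl' = lex-< (r<M r∈) (lex-< (≤-trans (i<M′ i<f) (n≤1+n _)) cl<cl')
  ... | inj₂ cl≡cl' = lex-< (r<M r∈) (lex-<-≡ cl≡cl' i<i')
  posKey-mono {cellTok i r} {cellTok i r'} _ _ (inj₂ (refl , r<r')) = lex-<-≡ {M} {cl i * M + i} refl r<r'

  valKey-mono : ∀ {x y} → Valid x → Valid y → x ⊏ᵥ y → valKey x < valKey y
  valKey-mono {kernelTok t} {kernelTok t'} _ _ ρt<ρt' = lex-< 0<M (lex-< 0<M ρt<ρt')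
  valKey-mono {kernelTok t} {cellTok i r} _ (i<f , _) ρt<cm with m≤n⇒m<n∨m≡n (<⇒≤pred ρt<cm)
  ... | inj₁ ρt<cm-1 = lex-< 0<M (lex-< 0<M ρt<cm-1)
  ... | inj₂ ρt≡cm-1 = lex-< 0<M (lex-<-≡ ρt≡cm-1 (m<n⇒0<n∸m i<f))
  valKey-mono {cellTok i r} {kernelTok t} (i<f , r∈) _ cm≤ρt =
    lex-< (αr<M i<f r∈) (lex-< (f∸i<M i) (<-≤-trans (∸-monoʳ-< (s≤s z≤n) (1≤cm i<f)) cm≤ρt))
  valKey-mono {cellTok i r} {cellTok i' r'} (i<f , r∈) _ (inj₁ i'<i) with m≤n⇒m<n∨m≡n (∸-monoˡ-≤ 1 (cm-antitone (<⇒≤ i'<i) i<f))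
  ... | inj₁ cm<cm' = lex-< (αr<M i<f r∈) (lex-< (f∸i<M i) cm<cm')
  ... | inj₂ cm≡cm' = lex-< (αr<M i<f r∈) (lex-<-≡ cm≡cm' (∸-monoʳ-< i'<i (<⇒≤ i<f)))
  valKey-mono {cellTok i r} {cellTok i r'} _ _ (inj₂ (refl , αr<αr')) = lex-<-≡ {M} {(cm i ∸ 1) * M + (f ∸ i)} refl αr<αr'

  ⊏ₚ-trichotomous : ∀ {x y} → Valid x → Valid y → x ⊏ₚ y ⊎ x ≡ y ⊎ y ⊏ₚ x
  ⊏ₚ-trichotomous {kernelTok t} {kernelTok t'} _ _ with <-cmp t t'
  ... | tri< t<t' _ _ = inj₁ t<t'
  ... | tri≈ _ refl _ = inj₂ (inj₁ refl)
  ... | tri> _ _ t'<t = inj₂ (inj₂ t'<t)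
  ⊏ₚ-trichotomous {kernelTok t} {cellTok i r} _ _ with t <? cl i
  ... | yes t<cl = inj₁ t<cl
  ... | no t≮cl = inj₂ (inj₂ (≮⇒≥ t≮cl))
  ⊏ₚ-trichotomous {cellTok i r} {kernelTok t} _ _ with t <? cl i
  ... | yes t<cl = inj₂ (inj₂ t<cl)
  ... | no t≮cl = inj₁ (≮⇒≥ t≮cl)
  ⊏ₚ-trichotomous {cellTok i r} {cellTok i' r'} _ _ with <-cmp i i' | <-cmp r r'
  ... | tri< i<i' _ _ | _ = inj₁ (inj₁ i<i')
  ... | tri> _ _ i'<i | _ = inj₂ (inj₂ (inj₁ i'<i))
  ... | tri≈ _ refl _ | tri< r<r' _ _ = inj₁ (inj₂ (refl , r<r'))
  ... | tri≈ _ refl _ | tri≈ _ refl _ = inj₂ (inj₁ refl)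
  ... | tri≈ _ refl _ | tri> _ _ r'<r = inj₂ (inj₂ (inj₂ (refl , r'<r)))

  ⊏ᵥ-trichotomous : ∀ {x y} → Valid x → Valid y → x ⊏ᵥ y ⊎ x ≡ y ⊎ y ⊏ᵥ x
  ⊏ᵥ-trichotomous {kernelTok t} {kernelTok t'} t∈ t'∈ with <-cmp (at ρ t) (at ρ t')
  ... | tri< lt _ _ = inj₁ lt
  ... | tri≈ _ eq _ = inj₂ (inj₁ (cong kernelTok (at-injective (IsPerm⇒unique (proj₁ kp)) t t' t∈ t'∈ eq)))
  ... | tri> _ _ gt = inj₂ (inj₂ gt)
  ⊏ᵥ-trichotomous {kernelTok t} {cellTok i r} _ _ with at ρ t <? cm i
  ... | yes lt = inj₁ lt
  ... | no nlt = inj₂ (inj₂ (≮⇒≥ nlt))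
  ⊏ᵥ-trichotomous {cellTok i r} {kernelTok t} _ _ with at ρ t <? cm i
  ... | yes lt = inj₂ (inj₂ lt)
  ... | no nlt = inj₁ (≮⇒≥ nlt)
  ⊏ᵥ-trichotomous {cellTok i r} {cellTok i' r'} (i<f , r∈) (_ , r'∈) with <-cmp i' i
  ... | tri< i'<i _ _ = inj₁ (inj₁ i'<i)
  ... | tri> _ _ i<i' = inj₂ (inj₂ (inj₁ i<i'))
  ... | tri≈ _ refl _ with <-cmp (at (α i) r) (at (α i) r')
  ...   | tri< lt _ _ = inj₁ (inj₂ (refl , lt))
  ...   | tri≈ _ eq _ = inj₂ (inj₁ (cong (cellTok i) (at-injective (IsPerm⇒unique (α-perm i<f)) r r' r∈ r'∈ eq)))
  ...   | tri> _ _ gt = inj₂ (inj₂ (inj₂ (refl , gt)))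

  cellToks : ℕ → List Token
  cellToks i = map (cellTok i) (applyUpTo suc (a i))

  tokens : List Token
  tokens = map kernelTok (applyUpTo suc s) ++ concat (applyUpTo cellToks f)

  n : ℕ
  n = length tokens

  private
    ∈-cellToks⁻ : ∀ {i x} → x ∈ cellToks i → Σ ℕ λ r → InRange (a i) r × x ≡ cellTok i r
    ∈-cellToks⁻ {i} x∈ with r , r∈ , refl ← ∈-map⁻ (cellTok i) x∈ = r , ∈-upTo⁻ r∈ , refl

    ∈-cellToks⁺ : ∀ {i r} → InRange (a i) r → cellTok i r ∈ cellToks i
    ∈-cellToks⁺ {i} r∈ = ∈-map⁺ (cellTok i) (∈-upTo⁺ r∈)

    ∈-concat-cellToks⁻ : ∀ {x} → x ∈ concat (applyUpTo cellToks f) → Σ ℕ λ i → i < f × x ∈ cellToks i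
    ∈-concat-cellToks⁻ x∈ with xs , x∈xs , xs∈ ← ∈-concat⁻′ (applyUpTo cellToks f) x∈
      with i , i<f , refl ← ∈-applyUpTo⁻ cellToks xs∈ = i , i<f , x∈xs

  token-valid : ∀ {x} → x ∈ tokens → Valid x
  token-valid {x} x∈ with ∈-++⁻ (map kernelTok (applyUpTo suc s)) x∈
  ... | inj₁ x∈ker with t , t∈ , refl ← ∈-map⁻ kernelTok x∈ker = ∈-upTo⁻ t∈
  ... | inj₂ x∈cells with i , i<f , x∈i ← ∈-concat-cellToks⁻ x∈cells
    with r , r∈ , refl ← ∈-cellToks⁻ x∈i = i<f , r∈

  valid-token : ∀ {x} → Valid x → x ∈ tokens
  valid-token {kernelTok t} t∈ = ∈-++⁺ˡ (∈-map⁺ kernelTok (∈-upTo⁺ t∈))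
  valid-token {cellTok i r} (i<f , r∈) =
    ∈-++⁺ʳ (map kernelTok (applyUpTo suc s)) (∈-concat⁺′ (∈-cellToks⁺ r∈) (∈-applyUpTo⁺ cellToks i<f))

  tokens-unique : Unique tokens
  tokens-unique = Uniqueₚ.++⁺
    (Uniqueₚ.map⁺ kernelTok-injective (sorted⇒unique (upTo-sorted s)))
    (Uniqueₚ.concat⁺ (All.tabulate cellToks-unique) (AllPairsₚ.applyUpTo⁺₁ cellToks f cellToks-disjoint))
    (λ (x∈ker , x∈cells) → kernel∉cells x∈ker x∈cells)
    where
    kernelTok-injective : ∀ {t t'} → kernelTok t ≡ kernelTok t' → t ≡ t'
    kernelTok-injective refl = refl
    cellTok-injective : ∀ {i r r'} → cellTok i r ≡ cellTok i r' → r ≡ r'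
    cellTok-injective refl = refl
    cellToks-unique : ∀ {xs} → xs ∈ applyUpTo cellToks f → Unique xs
    cellToks-unique xs∈ with _ , _ , refl ← ∈-applyUpTo⁻ cellToks xs∈ =
      Uniqueₚ.map⁺ cellTok-injective (sorted⇒unique (upTo-sorted _))
    cellToks-disjoint : ∀ {i j} → i < j → j < f → ∀ {x} → ¬ (x ∈ cellToks i × x ∈ cellToks j)
    cellToks-disjoint i<j _ (x∈i , x∈j) with _ , _ , refl ← ∈-cellToks⁻ x∈i | _ , _ , refl ← ∈-cellToks⁻ x∈j =
      <-irrefl refl i<j
    kernel∉cells : ∀ {x} → x ∈ map kernelTok (applyUpTo suc s) → x ∈ concat (applyUpTo cellToks f) → ⊥
    kernel∉cells x∈ker x∈cells with _ , _ , refl ← ∈-map⁻ kernelTok x∈ker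
      with _ , _ , x∈i ← ∈-concat-cellToks⁻ x∈cells
      with _ , _ , () ← ∈-cellToks⁻ x∈i

  module Pos = Ranking tokens tokens-unique posKey _⊏ₚ_
    (λ x∈ y∈ → posKey-mono (token-valid x∈) (token-valid y∈))
    (λ x∈ y∈ → ⊏ₚ-trichotomous (token-valid x∈) (token-valid y∈)) (kernelTok 0)
  module Val = Ranking tokens tokens-unique valKey _⊏ᵥ_
    (λ x∈ y∈ → valKey-mono (token-valid x∈) (token-valid y∈))
    (λ x∈ y∈ → ⊏ᵥ-trichotomous (token-valid x∈) (token-valid y∈)) (kernelTok 0)

  pos val : Token → ℕ
  pos = Pos.rank
  val = Val.rank

  valueAt : ℕ → ℕ
  valueAt j = val (Pos.unrank j)

  π : List ℕ
  π = map valueAt (applyUpTo suc n)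

  length-π : length π ≡ n
  length-π = trans (length-map valueAt (applyUpTo suc n)) (length-applyUpTo suc n)

  at-π-pos : ∀ {x} → x ∈ tokens → at π (pos x) ≡ val x
  at-π-pos x∈ = trans (at-map-upTo valueAt n _ (Pos.rank-inRange x∈)) (cong val (Pos.unrank-rank x∈))

  pos-inRange : ∀ {x} → x ∈ tokens → InRange (length π) (pos x)
  pos-inRange {x} x∈ with 1≤ , ≤n ← Pos.rank-inRange x∈ = 1≤ , subst (pos x ≤_) (sym length-π) ≤n

  π-perm : IsPerm π
  π-perm = subst (λ k → π ↭ applyUpTo suc k) (sym length-π) (begin
    map valueAt (applyUpTo suc n)             ↭⟨ ↭-map⁺ valueAt (↭-sym Pos.map-rank-↭) ⟩
    map valueAt (map pos tokens)              ≡⟨ sym (map-∘ tokens) ⟩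
    map (λ x → valueAt (pos x)) tokens        ≡⟨ map-cong-local (All.tabulate (λ x∈ → cong val (Pos.unrank-rank x∈))) ⟩
    map val tokens                            ↭⟨ Val.map-rank-↭ ⟩
    applyUpTo suc n                           ∎)
    where open PermutationReasoning

  posK : ℕ → ℕ
  posK t = pos (kernelTok t)

  is : List ℕ
  is = map posK (applyUpTo suc s)

  private
    kernelTok∈ : ∀ {t} → InRange s t → kernelTok t ∈ tokens
    kernelTok∈ = valid-token

    row≤s : ∀ {y} → Valid y → row y ≤ s
    row≤s {kernelTok t} t∈ = proj₂ (IsPerm⇒inRange (proj₁ kp) (at-∈ ρ t t∈))
    row≤s {cellTok i r} (i<f , _) = cm≤s i<f

  is-sorted : AllPairs _<_ is
  is-sorted = subst (AllPairs _<_) (sym (map-applyUpTo suc posK s))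
    (AllPairsₚ.applyUpTo⁺₁ (λ t → posK (suc t)) s
      (λ t<t' t'<s → Pos.rank-mono (kernelTok∈ (s≤s z≤n , <-trans t<t' t'<s)) (kernelTok∈ (s≤s z≤n , t'<s)) (s≤s t<t')))

  ∈-is⁻ : ∀ {p} → p ∈ is → Σ ℕ λ t → InRange s t × p ≡ posK t
  ∈-is⁻ p∈ with t , t∈ , refl ← ∈-map⁻ posK p∈ = t , ∈-upTo⁻ t∈ , refl

  ∈-is⁺ : ∀ {t} → InRange s t → posK t ∈ is
  ∈-is⁺ t∈ = ∈-map⁺ posK (∈-upTo⁺ t∈)

  val-top : val (kernelTok top) ≡ n
  val-top = Val.rank-maximum (kernelTok∈ top∈)
    (λ {y} y∈ ρtop<row → <⇒≱ ρtop<row (subst (row y ≤_) (sym at-top) (row≤s (token-valid y∈))))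

  at-π-top : at π (posK top) ≡ length π
  at-π-top = trans (at-π-pos (kernelTok∈ top∈)) (trans val-top (sym length-π))

  lift-occ : ∀ {i j k} → Occ132 ρ i j k → Occ132 π (posK i) (posK j) (posK k)
  lift-occ {i} {j} {k} o@(_ , i<j , j<k , _ , ρi<ρk , ρk<ρj) =
    proj₁ (pos-inRange i∈) , Pos.rank-mono i∈ j∈ i<j , Pos.rank-mono j∈ k∈ j<k , proj₂ (pos-inRange k∈) ,
    subst₂ _<_ (sym (at-π-pos i∈)) (sym (at-π-pos k∈)) (Val.rank-mono i∈ k∈ ρi<ρk) ,
    subst₂ _<_ (sym (at-π-pos k∈)) (sym (at-π-pos j∈)) (Val.rank-mono k∈ j∈ ρk<ρj)
    where
    i∈ = kernelTok∈ (proj₁ (Occ132-inRange ρ o))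
    j∈ = kernelTok∈ (proj₁ (proj₂ (Occ132-inRange ρ o)))
    k∈ = kernelTok∈ (proj₂ (proj₂ (Occ132-inRange ρ o)))

  liftᵛ : Vtx → Vtx
  liftᵛ (ent t) = ent (posK t)
  liftᵛ (occ i j k) = occ (posK i) (posK j) (posK k)

  lift-path : ∀ {u v} → Star (Adj ρ) u v → Star (Adj π) (liftᵛ u) (liftᵛ v)
  lift-path ε = ε
  lift-path (e-o o p∈ ◅ path) = e-o (lift-occ o) (Member-map posK p∈) ◅ lift-path path
  lift-path (o-e o p∈ ◅ path) = o-e (lift-occ o) (Member-map posK p∈) ◅ lift-path path

  ∈is⇒kernel : ∀ {p} → p ∈ is → InKernel π p
  ∈is⇒kernel p∈ with t , t∈ , refl ← ∈-is⁻ p∈ =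
    proj₁ (pos-inRange (kernelTok∈ t∈)) , proj₂ (pos-inRange (kernelTok∈ t∈)) ,
    posK top , proj₁ (pos-inRange (kernelTok∈ top∈)) , proj₂ (pos-inRange (kernelTok∈ top∈)) , at-π-top ,
    lift-path (reaches-top t∈)

  IsKernelTok : Token → Set
  IsKernelTok (kernelTok _) = ⊤
  IsKernelTok (cellTok _ _) = ⊥

  private
    ⊏ₚ-cells⇒≤ : ∀ {i r i' r'} → cellTok i r ⊏ₚ cellTok i' r' → i ≤ i'
    ⊏ₚ-cells⇒≤ (inj₁ i<i') = <⇒≤ i<i'
    ⊏ₚ-cells⇒≤ (inj₂ (refl , _)) = ≤-refl

    ⊏ᵥ-cells⇒≥ : ∀ {i r i' r'} → cellTok i r ⊏ᵥ cellTok i' r' → i' ≤ i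
    ⊏ᵥ-cells⇒≥ (inj₁ i'<i) = <⇒≤ i'<i
    ⊏ᵥ-cells⇒≥ (inj₂ (refl , _)) = ≤-refl

    infeasible-cell : ∀ {i} → i < f → ¬ Infeasible ρ (cell i)
    infeasible-cell i<f = proj₂ (proj₂ (proj₂ (proj₂ (cell-feasible i<f))))

    module Ins {i} (i<f : i < f) = Insertion ρ (1≤cm i<f) (1≤cl i<f) (cl≤1+s i<f)

  -- A 132-occurrence mixing kernel and cell tokens would make a cell infeasible, put a kernel
  -- entry south-west of a cell, or contradict the ≺-order of two cells.
  occurrence-kernel-closed : ∀ {x y z} → Valid x → Valid y → Valid z →
    x ⊏ₚ y → y ⊏ₚ z → x ⊏ᵥ z → z ⊏ᵥ y →
    IsKernelTok x ⊎ IsKernelTok y ⊎ IsKernelTok z → IsKernelTok x × IsKernelTok y × IsKernelTok z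
  occurrence-kernel-closed {kernelTok _} {kernelTok _} {kernelTok _} _ _ _ _ _ _ _ _ = tt , tt , tt
  occurrence-kernel-closed {cellTok _ _} {cellTok _ _} {cellTok _ _} _ _ _ _ _ _ _ (inj₁ ())
  occurrence-kernel-closed {cellTok _ _} {cellTok _ _} {cellTok _ _} _ _ _ _ _ _ _ (inj₂ (inj₁ ()))
  occurrence-kernel-closed {cellTok _ _} {cellTok _ _} {cellTok _ _} _ _ _ _ _ _ _ (inj₂ (inj₂ ()))
  occurrence-kernel-closed {kernelTok _} {kernelTok _} {cellTok _ _} (1≤t , _) _ (i<f , _) p₁ p₂ v₁ v₂ _ =
    ⊥-elim (infeasible-cell i<f (Ins.infeasible-as-2 i<f 1≤t p₁ p₂ v₁ v₂))
  occurrence-kernel-closed {kernelTok _} {cellTok _ _} {kernelTok _} (1≤t , _) (i<f , _) (_ , t₃≤s) p₁ p₂ v₁ v₂ _ =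
    ⊥-elim (infeasible-cell i<f (Ins.infeasible-as-3 i<f 1≤t p₁ p₂ t₃≤s v₁ v₂))
  occurrence-kernel-closed {cellTok _ _} {kernelTok _} {kernelTok _} (i<f , _) _ (_ , t₃≤s) p₁ p₂ v₁ v₂ _ =
    ⊥-elim (infeasible-cell i<f (Ins.infeasible-as-1 i<f p₁ p₂ t₃≤s v₁ v₂))
  occurrence-kernel-closed {kernelTok _} {cellTok _ _} {cellTok _ _} t∈ (i<f , _) (i'<f , _) p₁ p₂ v₁ v₂ _ =
    ⊥-elim (feasible⇒southWest-empty conn (cell-feasible i<f) t∈ p₁
      (<-≤-trans v₁ (cm-antitone (⊏ₚ-cells⇒≤ p₂) i'<f)))
  occurrence-kernel-closed {cellTok _ _} {kernelTok _} {cellTok _ _} (i<f , _) _ _ p₁ p₂ v₁ _ _ =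
    ⊥-elim (<-irrefl refl (<-≤-trans p₂ (≤-trans (cl-monotone (⊏ᵥ-cells⇒≥ v₁) i<f) p₁)))
  occurrence-kernel-closed {cellTok _ _} {cellTok _ _} {kernelTok _} _ (i'<f , _) _ p₁ _ v₁ v₂ _ =
    ⊥-elim (<-irrefl refl (<-≤-trans v₂ (≤-trans (cm-antitone (⊏ₚ-cells⇒≤ p₁) i'<f) v₁)))

  π<⇔⊏ᵥ : ∀ {x y} → x ∈ tokens → y ∈ tokens → at π (pos x) < at π (pos y) ⇔ x ⊏ᵥ y
  π<⇔⊏ᵥ x∈ y∈ = mk⇔
    (λ πx<πy → Val.rank-reflects x∈ y∈ (subst₂ _<_ (at-π-pos x∈) (at-π-pos y∈) πx<πy))
    (λ x⊏y → subst₂ _<_ (sym (at-π-pos x∈)) (sym (at-π-pos y∈)) (Val.rank-mono x∈ y∈ x⊏y))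

  decode : ∀ {j} → InRange (length π) j → Σ Token λ x → x ∈ tokens × j ≡ pos x
  decode {j} (1≤j , j≤) with x∈ , pos≡j ← Pos.unrank-spec (1≤j , subst (j ≤_) length-π j≤) =
    Pos.unrank j , x∈ , sym pos≡j

  pos∈is⇒kernelTok : ∀ {x} → x ∈ tokens → pos x ∈ is → IsKernelTok x
  pos∈is⇒kernelTok x∈ px∈ with t , t∈ , px≡ ← ∈-is⁻ px∈ with refl ← Pos.rank-injective x∈ (kernelTok∈ t∈) px≡ = tt

  kernelTok⇒pos∈is : ∀ {x} → x ∈ tokens → IsKernelTok x → pos x ∈ is
  kernelTok⇒pos∈is {kernelTok t} x∈ _ = ∈-is⁺ (token-valid x∈)

  occ-closed : ∀ {i j k p} → Occ132 π i j k → Member p i j k → p ∈ is → i ∈ is × j ∈ is × k ∈ is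
  occ-closed {i} {j} {k} {p} o@(_ , i<j , j<k , _ , πi<πk , πk<πj) p-mem p∈
    with x , x∈ , refl ← decode (proj₁ (Occ132-inRange π o))
       | y , y∈ , refl ← decode (proj₁ (proj₂ (Occ132-inRange π o)))
       | z , z∈ , refl ← decode (proj₂ (proj₂ (Occ132-inRange π o)))
    with occurrence-kernel-closed (token-valid x∈) (token-valid y∈) (token-valid z∈)
           (Pos.rank-reflects x∈ y∈ i<j) (Pos.rank-reflects y∈ z∈ j<k)
           (Equivalence.to (π<⇔⊏ᵥ x∈ z∈) πi<πk) (Equivalence.to (π<⇔⊏ᵥ z∈ y∈) πk<πj) (some-kernel p-mem)
    where
    some-kernel : Member p (pos x) (pos y) (pos z) → IsKernelTok x ⊎ IsKernelTok y ⊎ IsKernelTok z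
    some-kernel (inj₁ refl) = inj₁ (pos∈is⇒kernelTok x∈ p∈)
    some-kernel (inj₂ (inj₁ refl)) = inj₂ (inj₁ (pos∈is⇒kernelTok y∈ p∈))
    some-kernel (inj₂ (inj₂ refl)) = inj₂ (inj₂ (pos∈is⇒kernelTok z∈ p∈))
  ... | kx , ky , kz = kernelTok⇒pos∈is x∈ kx , kernelTok⇒pos∈is y∈ ky , kernelTok⇒pos∈is z∈ kz

  private
    InIsᵛ : Vtx → Set
    InIsᵛ (ent p) = p ∈ is
    InIsᵛ (occ i j k) = i ∈ is × j ∈ is × k ∈ is

    InIs-back : ∀ {u v} → Adj π u v → InIsᵛ v → InIsᵛ u
    InIs-back (e-o _ (inj₁ refl)) (p∈ , _ , _) = p∈
    InIs-back (e-o _ (inj₂ (inj₁ refl))) (_ , p∈ , _) = p∈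
    InIs-back (e-o _ (inj₂ (inj₂ refl))) (_ , _ , p∈) = p∈
    InIs-back (o-e o p-mem) p∈ = occ-closed o p-mem p∈

    InIs-back* : ∀ {u v} → Star (Adj π) u v → InIsᵛ v → InIsᵛ u
    InIs-back* ε v∈ = v∈
    InIs-back* (e ◅ path) v∈ = InIs-back e (InIs-back* path v∈)

  kernel⇒∈is : ∀ {p} → InKernel π p → p ∈ is
  kernel⇒∈is (_ , _ , q , 1≤q , q≤ , at-q , path) with x , x∈ , refl ← decode (1≤q , q≤) = InIs-back* path posx∈is
    where
    x≡top : x ≡ kernelTok top
    x≡top = Val.rank-injective x∈ (kernelTok∈ top∈)
      (trans (sym (at-π-pos x∈)) (trans at-q (trans length-π (sym val-top))))
    posx∈is : pos x ∈ is
    posx∈is = subst (λ x → pos x ∈ is) (sym x≡top) (∈-is⁺ top∈)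

  kernelPos : KernelPos π is
  kernelPos = is-sorted , λ p → mk⇔ ∈is⇒kernel kernel⇒∈is

  kernelIso : OrderIso (map (at π) is) ρ
  kernelIso = subst (λ xs → OrderIso xs ρ) (map-∘ (applyUpTo suc s))
    (OrderIso-tabulate (λ t → at π (posK t)) s ρ refl (λ a∈ b∈ → π<⇔⊏ᵥ (kernelTok∈ a∈) (kernelTok∈ b∈)))

  private
    T<ᵇ⇔< : ∀ {m n} → T (m <ᵇ n) ⇔ m < n
    T<ᵇ⇔< {m} {n} = mk⇔ (<ᵇ⇒< m n) <⇒<ᵇ

    m∸1<n⇒m≤n : ∀ {m n} → m ∸ 1 < n → m ≤ n
    m∸1<n⇒m≤n {zero} _ = z≤n
    m∸1<n⇒m≤n {suc m} m<n = m<n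

    pos<⇔⊏ₚ : ∀ {x y} → x ∈ tokens → y ∈ tokens → pos x < pos y ⇔ x ⊏ₚ y
    pos<⇔⊏ₚ x∈ y∈ = mk⇔ (Pos.rank-reflects x∈ y∈) (Pos.rank-mono x∈ y∈)

    1≤column : ∀ {x} → Valid x → 1 ≤ column x
    1≤column {kernelTok t} (1≤t , _) = 1≤t
    1≤column {cellTok i r} (i<f , _) = 1≤cl i<f

    1≤row : ∀ {x} → Valid x → 1 ≤ row x
    1≤row {kernelTok t} t∈ = proj₁ (IsPerm⇒inRange (proj₁ kp) (at-∈ ρ t t∈))
    1≤row {cellTok i r} (i<f , _) = 1≤cm i<f

    ⊏ₚ-end : ∀ {x} → Valid x → x ⊏ₚ kernelTok (suc s)
    ⊏ₚ-end {kernelTok t} (_ , t≤s) = s≤s t≤s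
    ⊏ₚ-end {cellTok i r} (i<f , _) = cl≤1+s i<f

    length-is : length is ≡ s
    length-is = trans (length-map posK (applyUpTo suc s)) (length-applyUpTo suc s)

    bnd-kernel : ∀ {u} → InRange s u → bnd π is u ≡ posK u
    bnd-kernel {suc u} (_ , u<s) with suc u ≡ᵇ suc (length is) in eq
    ... | true = ⊥-elim (<-irrefl (trans (≡ᵇ⇒≡ u (length is) (subst T (sym eq) tt)) length-is) u<s)
    ... | false = at-map-upTo posK s (suc u) (s≤s z≤n , u<s)

    bnd-end : bnd π is (suc s) ≡ suc (length π)
    bnd-end with suc s ≡ᵇ suc (length is) in eq
    ... | true = refl
    ... | false = ⊥-elim (subst T eq (≡⇒≡ᵇ s (length is) (sym length-is)))

    kernelOfValue : ℕ → ℕ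
    kernelOfValue v = idx v ρ

    kernelOfValue-spec : ∀ {v} → InRange s v → InRange s (kernelOfValue v) × at ρ (kernelOfValue v) ≡ v
    kernelOfValue-spec v∈ = at-idx (inRange⇒∈IsPerm (proj₁ kp) v∈)

    kval-kernel : ∀ {v} → InRange s v → kval π is ρ v ≡ at π (posK (kernelOfValue v))
    kval-kernel {suc v} v∈ = cong (at π) (at-map-upTo posK s _ (proj₁ (kernelOfValue-spec v∈)))

  left-test : ∀ {l x} → 1 ≤ l → l ≤ suc s → x ∈ tokens →
    T (bnd π is (l ∸ 1) <ᵇ pos x) ⇔ kernelTok (l ∸ 1) ⊏ₚ x
  left-test {1} {x} _ _ x∈ =
    mk⇔ (λ _ → 1≤column (token-valid x∈)) (λ _ → <⇒<ᵇ (proj₁ (Pos.rank-inRange x∈)))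
  left-test {suc (suc u)} {x} _ l≤ x∈ = subst (λ b → T (b <ᵇ pos x) ⇔ kernelTok (suc u) ⊏ₚ x) (sym (bnd-kernel u∈))
    (pos<⇔⊏ₚ (kernelTok∈ u∈) x∈ ⇔-∘ T<ᵇ⇔<)
    where
    u∈ : InRange s (suc u)
    u∈ = s≤s z≤n , ≤-pred l≤

  right-test : ∀ {l x} → 1 ≤ l → l ≤ suc s → x ∈ tokens → T (pos x <ᵇ bnd π is l) ⇔ x ⊏ₚ kernelTok l
  right-test {l} {x} 1≤l l≤ x∈ with l ≤? s
  ... | yes l≤s = subst (λ b → T (pos x <ᵇ b) ⇔ x ⊏ₚ kernelTok l) (sym (bnd-kernel (1≤l , l≤s)))
    (pos<⇔⊏ₚ x∈ (kernelTok∈ (1≤l , l≤s)) ⇔-∘ T<ᵇ⇔<)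
  ... | no l≰s with refl ← ≤-antisym l≤ (≰⇒> l≰s) = subst (λ b → T (pos x <ᵇ b) ⇔ x ⊏ₚ kernelTok l) (sym bnd-end)
    (mk⇔ (λ _ → ⊏ₚ-end (token-valid x∈)) (λ _ → <⇒<ᵇ (s≤s (proj₂ (pos-inRange x∈)))))

  lower-test : ∀ {m x} → 1 ≤ m → m ≤ s → x ∈ tokens → T (kval π is ρ (m ∸ 1) <ᵇ at π (pos x)) ⇔ m ∸ 1 < row x
  lower-test {1} {x} _ _ x∈ = mk⇔ (λ _ → 1≤row (token-valid x∈))
    (λ _ → <⇒<ᵇ (subst (1 ≤_) (sym (at-π-pos x∈)) (proj₁ (Val.rank-inRange x∈))))
  lower-test {suc (suc v)} {x} _ m≤s x∈ =
    subst (λ b → T (b <ᵇ at π (pos x)) ⇔ suc v < row x) (sym (kval-kernel v∈))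
      (subst (λ u → at π (posK w) < at π (pos x) ⇔ u < row x) ρw≡ (π<⇔⊏ᵥ (kernelTok∈ w∈) x∈) ⇔-∘ T<ᵇ⇔<)
    where
    v∈ : InRange s (suc v)
    v∈ = s≤s z≤n , <⇒≤ m≤s
    w = kernelOfValue (suc v)
    w∈ = proj₁ (kernelOfValue-spec v∈)
    ρw≡ = proj₂ (kernelOfValue-spec v∈)

  upper-test : ∀ {m x} → 1 ≤ m → m ≤ s → x ∈ tokens →
    T (at π (pos x) <ᵇ kval π is ρ m) ⇔ x ⊏ᵥ kernelTok (kernelOfValue m)
  upper-test {m} {x} 1≤m m≤s x∈ =
    subst (λ b → T (at π (pos x) <ᵇ b) ⇔ x ⊏ᵥ kernelTok (kernelOfValue m)) (sym (kval-kernel (1≤m , m≤s)))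
      (π<⇔⊏ᵥ x∈ (kernelTok∈ (proj₁ (kernelOfValue-spec (1≤m , m≤s)))) ⇔-∘ T<ᵇ⇔<)

  in-cell⇔ : ∀ {i x} → i < f → x ∈ tokens →
    T (inCellᵇ π is ρ (cm i) (cl i) (pos x)) ⇔ (Σ ℕ λ r → InRange (a i) r × x ≡ cellTok i r)
  in-cell⇔ {i} {x} i<f x∈ = mk⇔ (λ inCell → to x x∈ (tests inCell)) from
    where
    ρw≡cm : at ρ (kernelOfValue (cm i)) ≡ cm i
    ρw≡cm = proj₂ (kernelOfValue-spec (1≤cm i<f , cm≤s i<f))
    left = left-test (1≤cl i<f) (cl≤1+s i<f)
    right = right-test (1≤cl i<f) (cl≤1+s i<f)
    lower = lower-test (1≤cm i<f) (cm≤s i<f)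
    upper = upper-test (1≤cm i<f) (cm≤s i<f)
    InCell : Token → Set
    InCell y = kernelTok (cl i ∸ 1) ⊏ₚ y × y ⊏ₚ kernelTok (cl i) × cm i ∸ 1 < row y ×
               y ⊏ᵥ kernelTok (kernelOfValue (cm i))
    tests : T (inCellᵇ π is ρ (cm i) (cl i) (pos x)) → InCell x
    tests inCell with t₁ , rest ← Equivalence.to T-∧ inCell with t₂ , rest ← Equivalence.to T-∧ rest
                 with t₃ , t₄ ← Equivalence.to T-∧ rest =
      Equivalence.to (left x∈) t₁ , Equivalence.to (right x∈) t₂ , Equivalence.to (lower x∈) t₃ ,
      Equivalence.to (upper x∈) t₄
    to : ∀ y → y ∈ tokens → InCell y → Σ ℕ λ r → InRange (a i) r × y ≡ cellTok i r
    to (kernelTok t) _ (cl∸1<t , t<cl , _) = ⊥-elim (<⇒≱ t<cl (m∸1<n⇒m≤n cl∸1<t))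
    to (cellTok i' r') y∈ (cl∸1<cl' , cl'≤cl , cm∸1<cm' , cm'≤ρw) with i'<f , r'∈ ← token-valid y∈
      with refl ← cell-injective i'<f i<f
        (≤-antisym (subst (cm i' ≤_) ρw≡cm cm'≤ρw) (m∸1<n⇒m≤n cm∸1<cm'))
        (≤-antisym cl'≤cl (m∸1<n⇒m≤n cl∸1<cl')) = r' , r'∈ , refl
    from : (Σ ℕ λ r → InRange (a i) r × x ≡ cellTok i r) → T (inCellᵇ π is ρ (cm i) (cl i) (pos x))
    from (r , r∈ , refl) = Equivalence.from T-∧ (Equivalence.from (left x∈) (∸-monoʳ-< (s≤s z≤n) (1≤cl i<f)) ,
      Equivalence.from T-∧ (Equivalence.from (right x∈) ≤-refl ,
      Equivalence.from T-∧ (Equivalence.from (lower x∈) (∸-monoʳ-< (s≤s z≤n) (1≤cm i<f)) ,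
      Equivalence.from (upper x∈) (≤-reflexive (sym ρw≡cm)))))

  cellPositions : ℕ → List ℕ
  cellPositions i = map (λ r → pos (cellTok i r)) (applyUpTo suc (a i))

  cell-positions : ∀ {i} → i < f →
    filterᵇ (inCellᵇ π is ρ (cm i) (cl i)) (applyUpTo suc (length π)) ≡ cellPositions i
  cell-positions {i} i<f =
    strictlySorted-ext (AllPairsₚ.filter⁺ (λ j → T? (inCell j)) (upTo-sorted (length π))) sorted filter⊆ ⊆filter
    where
    inCell = inCellᵇ π is ρ (cm i) (cl i)
    cellTok∈ : ∀ {r} → InRange (a i) r → cellTok i r ∈ tokens
    cellTok∈ r∈ = valid-token (i<f , r∈)
    sorted : AllPairs _<_ (cellPositions i)
    sorted = subst (AllPairs _<_) (sym (map-applyUpTo suc (λ r → pos (cellTok i r)) (a i)))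
      (AllPairsₚ.applyUpTo⁺₁ (λ r → pos (cellTok i (suc r))) (a i) (λ r<r' r'<a →
        Pos.rank-mono (cellTok∈ (s≤s z≤n , <-trans r<r' r'<a)) (cellTok∈ (s≤s z≤n , r'<a)) (inj₂ (refl , s≤s r<r'))))
    filter⊆ : ∀ {v} → v ∈ filterᵇ inCell (applyUpTo suc (length π)) → v ∈ cellPositions i
    filter⊆ v∈ with v∈upTo , v-inCell ← ∈-filter⁻ (λ j → T? (inCell j)) v∈
      with x , x∈ , refl ← decode (∈-upTo⁻ v∈upTo)
      with r , r∈ , refl ← Equivalence.to (in-cell⇔ i<f x∈) v-inCell = ∈-map⁺ (λ r → pos (cellTok i r)) (∈-upTo⁺ r∈)
    ⊆filter : ∀ {v} → v ∈ cellPositions i → v ∈ filterᵇ inCell (applyUpTo suc (length π))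
    ⊆filter v∈ with r , r∈ , refl ← ∈-map⁻ (λ r → pos (cellTok i r)) v∈ =
      ∈-filter⁺ (λ j → T? (inCell j)) (∈-upTo⁺ (pos-inRange (cellTok∈ (∈-upTo⁻ r∈))))
        (Equivalence.from (in-cell⇔ i<f (cellTok∈ (∈-upTo⁻ r∈))) (r , ∈-upTo⁻ r∈ , refl))

  cellIso : ∀ {i} → i < f → OrderIso (cellSeq π is ρ (cell i)) (α i)
  cellIso {i} i<f =
    subst (λ xs → OrderIso xs (α i)) (trans (map-∘ (applyUpTo suc (a i))) (cong (map (at π)) (sym (cell-positions i<f))))
      (OrderIso-tabulate (λ r → at π (pos (cellTok i r))) (a i) (α i) refl
        (λ r∈ r'∈ → same-cell ⇔-∘ π<⇔⊏ᵥ (valid-token (i<f , r∈)) (valid-token (i<f , r'∈))))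
    where
    same-cell : ∀ {r r'} → cellTok i r ⊏ᵥ cellTok i r' ⇔ at (α i) r < at (α i) r'
    same-cell = mk⇔ (λ { (inj₁ i<i) → ⊥-elim (<-irrefl refl i<i) ; (inj₂ (_ , lt)) → lt }) (λ lt → inj₂ (refl , lt))

  cells : Pointwise (λ c α → OrderIso (cellSeq π is ρ c) α) cs αs
  cells = Pointwise-tabulate cs αs {dx = 0 , 0} {dy = []} (sym len-αs) (λ i i<f → cellIso i<f)

theorem3 : (ρ : List ℕ) → KernelPerm ρ →
    (cs : List (ℕ × ℕ)) → (∀ c → (c ∈ cs) ⇔ Feasible ρ c) → AllPairs Prec cs →
    (αs : List (List ℕ)) → All IsPerm αs → length αs ≡ length cs →
    Σ (List ℕ) λ π → IsPerm π × Σ (List ℕ) λ is →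
      KernelPos π is × OrderIso (map (at π) is) ρ ×
      Pointwise (λ c α → OrderIso (cellSeq π is ρ c) α) cs αs
theorem3 [] _ [] _ _ [] _ _ =
  [] , ↭-refl , [] , ([] , λ _ → mk⇔ (λ ()) (λ (1≤p , p≤0 , _) → ⊥-elim (<⇒≱ 1≤p p≤0))) ,
  (refl , λ _ _ 1≤a a≤0 _ _ → ⊥-elim (<⇒≱ 1≤a a≤0)) , []
theorem3 [] _ (c ∷ _) cs⇔ _ _ _ _ with 1≤m , m≤0 , _ ← Equivalence.to (cs⇔ c) (here refl) = ⊥-elim (<⇒≱ 1≤m m≤0)
theorem3 ρ@(_ ∷ _) kp cs cs⇔ cs-sorted αs αs-perm len-αs = π , π-perm , is , kernelPos , kernelIso , cells
  where open Construction kp (s≤s z≤n) cs (λ {c} → Equivalence.to (cs⇔ c)) cs-sorted αs αs-perm len-αs
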